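{- (Type reduction.) Let $g:\mathbb N\to\mathbb N$ satisfy $h<g(h)$ for all $h$. For every environment $C$ and terms $T,T_1,T_2$: if $C\vdash_g T:T_1$ and $C\vdash T_1\to^*T_2$, then $C\vdash_g T:T_2$.
   Context: Terms of $\lambda\delta$: $T ::= \ast h \mid x \mid \lambda x{:}W.\,T \mid \delta x{=}V.\,T \mid \mathrm{appl}(V,T) \mid \mathrm{cast}(W,T)$ ($h\in\mathbb N$, $x$ a variable); $\ast h$ is a sort, $\lambda x{:}W.T$ abstraction over type $W$, $\delta x{=}V.T$ the abbreviation "let $x=V$ in $T$", $\mathrm{appl}(V,T)$ application of $T$ to argument $V$, $\mathrm{cast}(W,T)$ $T$ annotated with type $W$. In $\lambda x{:}W.T$, $\delta x{=}V.T$, $x$ is bound in $T$ only; $\mathrm{FV}(T)$ free variables; terms up to renaming of bound variables with bound and free names disjoint. Environments: $E ::= \ast h \mid \lambda x{:}W.E \mid \delta x{=}V.E \mid \mathrm{appl}(V,E)\mid\mathrm{cast}(W,E)$. $E.\lambda x{:}W$ (resp. $E.\delta x{=}V$) is $E$ with its terminal sort $\ast h$ replaced by $\lambda x{:}W.\ast h$ (resp. $\delta x{=}V.\ast h$). $E=C_1\cdot\beta\cdot C_2$, for an item $\beta$ of the form $\lambda x{:}W$ or $\delta x{=}V$, means $E$ is obtained from the environment $C_1$ by replacing its terminal sort with $\beta.C_2$ for some environment $C_2$. Strict substitution: $T[x:=^+W]\,T'$ iff $x\notin\mathrm{FV}(W)$, $x\in\mathrm{FV}(T)$ and $T'$ arises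 from $T$ by replacing a nonempty set of free occurrences of $x$ by $W$. Environment-free parallel reduction $\to_0$: least relation closed under (refl) $T\to_0T$; (compatibility) if $A_1\to_0A_2$, $T_1\to_0T_2$ then $\lambda x{:}A_1.T_1\to_0\lambda x{:}A_2.T_2$, $\delta x{=}A_1.T_1\to_0\delta x{=}A_2.T_2$, $\mathrm{appl}(A_1,T_1)\to_0\mathrm{appl}(A_2,T_2)$, $\mathrm{cast}(A_1,T_1)\to_0\mathrm{cast}(A_2,T_2)$; ($\beta$) if $V_1\to_0V_2$, $T_1\to_0T_2$ then $\mathrm{appl}(V_1,\lambda x{:}W.T_1)\to_0\delta x{=}V_2.T_2$; ($\delta$) if $V_1\to_0V_2$, $T_1\to_0T_2$, $T_2[x:=^+V_2]T$ then $\delta x{=}V_1.T_1\to_0\delta x{=}V_2.T$; ($\zeta$) if $T_1\to_0T_2$, $x\notin\mathrm{FV}(T_1)$ then $\delta x{=}V.T_1\to_0T_2$; ($\tau$) if $T_1\to_0T_2$ then $\mathrm{cast}(W,T_1)\to_0T_2$; ($\upsilon$) if $V_1\to_0V_3$, $V_2\to_0V_4$, $T_1\to_0T_2$ then $\mathrm{appl}(V_1,\delta x{=}V_2.T_1)\to_0\delta x{=}V_4.\mathrm{appl}(V_3,T_2)$. $E\vdash T_1\to T_2$ iff $T_1\to_0T_2$, or $E=C_1\cdot\delta x{=}V\cdot C_2$, $T_1\to_0T'$, $T'[x:=^+V]T_2$. $E\vdash T_1\to^*T_2$ is its transitive closure; conversion $E\vdash T_1\Leftrightarrow T_2$ is its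 symmetric and transitive closure. Native type assignment $E\vdash_g T:U$ is the least relation closed under: (sort) $E\vdash_g\ast h:\ast g(h)$; (def) if $E=C_1\cdot\delta x{=}V\cdot C_2$ and $C_1\vdash_g V:W$ then $E\vdash_g x:W$; (decl) if $E=C_1\cdot\lambda x{:}W\cdot C_2$ and $C_1\vdash_g W:V$ then $E\vdash_g x:W$; (abbr) if $E\vdash_g V:W$ and $E.\delta x{=}V\vdash_g T:U$ then $E\vdash_g\delta x{=}V.T:\delta x{=}V.U$; (abst) if $E\vdash_g W:V$ and $E.\lambda x{:}W\vdash_g T:U$ then $E\vdash_g\lambda x{:}W.T:\lambda x{:}W.U$; (appl) if $E\vdash_g V:W$ and $E\vdash_g T:\lambda x{:}W.U$ then $E\vdash_g\mathrm{appl}(V,T):\mathrm{appl}(V,\lambda x{:}W.U)$; (cast) if $E\vdash_g T:W$ and $E\vdash_g W:V$ then $E\vdash_g\mathrm{cast}(W,T):\mathrm{cast}(V,W)$; (conv) if $E\vdash_g U_2:W$, $E\vdash_g T:U_1$ and $E\vdash U_1\Leftrightarrow U_2$ then $E\vdash_g T:U_2$. -}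

module Defs where

open import Data.Nat using (ℕ; zero; suc; _+_; _<ᵇ_)
open import Data.Bool using (Bool; true; false; _∨_; if_then_else_)
open import Data.Empty using (⊥)
open import Relation.Nullary using (¬_)
open import Relation.Binary.PropositionalEquality using (_≡_)
open import Data.Product using (_×_; ∃; ∃-syntax)
open import Data.Sum using (_⊎_)
open import Relation.Binary.Construct.Closure.Transitive using (TransClosure)
open import Relation.Binary.Construct.Closure.Symmetric using (SymClosure)

-- Terms of λδ, with de Bruijn indices for variables (this realises
-- "terms up to renaming of bound variables").  Index 0 refers to the
-- innermost enclosing binder (λ or δ).

data Term : Set where
  ⋆    : ℕ → Term
  #    : ℕ → Term
  𝛌    : Term → Term → Term       -- λ x:W. T   (T under one binder)
  𝛅    : Term → Term → Term       -- δ x=V. T   (T under one binder)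
  appl : Term → Term → Term
  cast : Term → Term → Term

shift : ℕ → ℕ → Term → Term
shift d c (⋆ h)      = ⋆ h
shift d c (# i)      = if i <ᵇ c then # i else # (i + d)
shift d c (𝛌 W T)    = 𝛌 (shift d c W) (shift d (suc c) T)
shift d c (𝛅 V T)    = 𝛅 (shift d c V) (shift d (suc c) T)
shift d c (appl V T) = appl (shift d c V) (shift d c T)
shift d c (cast W T) = cast (shift d c W) (shift d c T)

data Occurs : ℕ → Term → Set where
  var   : ∀ {i} → Occurs i (# i)
  𝛌ˡ    : ∀ {i W T} → Occurs i W → Occurs i (𝛌 W T)
  𝛌ʳ    : ∀ {i W T} → Occurs (suc i) T → Occurs i (𝛌 W T)
  𝛅ˡ    : ∀ {i V T} → Occurs i V → Occurs i (𝛅 V T)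
  𝛅ʳ    : ∀ {i V T} → Occurs (suc i) T → Occurs i (𝛅 V T)
  applˡ : ∀ {i V T} → Occurs i V → Occurs i (appl V T)
  applʳ : ∀ {i V T} → Occurs i T → Occurs i (appl V T)
  castˡ : ∀ {i W T} → Occurs i W → Occurs i (cast W T)
  castʳ : ∀ {i W T} → Occurs i T → Occurs i (cast W T)

-- Substitution of W for a (possibly empty) set of free occurrences of
-- the variable i in T, giving T'.  The Bool index records whether the
-- set of replaced occurrences is nonempty.

data Sub : ℕ → Term → Bool → Term → Term → Set where
  sort  : ∀ {i W h} → Sub i W false (⋆ h) (⋆ h)
  keep  : ∀ {i W j} → Sub i W false (# j) (# j)
  repl  : ∀ {i W} → Sub i W true (# i) W
  𝛌    : ∀ {i W b₁ b₂ A A′ T T′} → Sub i W b₁ A A′ →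
          Sub (suc i) (shift 1 0 W) b₂ T T′ → Sub i W (b₁ ∨ b₂) (𝛌 A T) (𝛌 A′ T′)
  𝛅    : ∀ {i W b₁ b₂ A A′ T T′} → Sub i W b₁ A A′ →
          Sub (suc i) (shift 1 0 W) b₂ T T′ → Sub i W (b₁ ∨ b₂) (𝛅 A T) (𝛅 A′ T′)
  appl  : ∀ {i W b₁ b₂ A A′ T T′} → Sub i W b₁ A A′ →
          Sub i W b₂ T T′ → Sub i W (b₁ ∨ b₂) (appl A T) (appl A′ T′)
  cast  : ∀ {i W b₁ b₂ A A′ T T′} → Sub i W b₁ A A′ →
          Sub i W b₂ T T′ → Sub i W (b₁ ∨ b₂) (cast A T) (cast A′ T′)

-- Strict substitution  T[x:=⁺W]T'  (x = index i): x ∉ FV(W) and a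
-- nonempty set of free occurrences of x in T is replaced by W
-- (nonemptiness implies x ∈ FV(T)).
StrictSubst : ℕ → Term → Term → Term → Set
StrictSubst i W T T′ = ¬ Occurs i W × Sub i W true T T′

infix 4 _→₀_
data _→₀_ : Term → Term → Set where
  refl  : ∀ {T} → T →₀ T
  𝛌    : ∀ {A₁ A₂ T₁ T₂} → A₁ →₀ A₂ → T₁ →₀ T₂ → 𝛌 A₁ T₁ →₀ 𝛌 A₂ T₂
  𝛅    : ∀ {A₁ A₂ T₁ T₂} → A₁ →₀ A₂ → T₁ →₀ T₂ → 𝛅 A₁ T₁ →₀ 𝛅 A₂ T₂
  appl  : ∀ {A₁ A₂ T₁ T₂} → A₁ →₀ A₂ → T₁ →₀ T₂ → appl A₁ T₁ →₀ appl A₂ T₂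
  cast  : ∀ {A₁ A₂ T₁ T₂} → A₁ →₀ A₂ → T₁ →₀ T₂ → cast A₁ T₁ →₀ cast A₂ T₂
  β     : ∀ {V₁ V₂ W T₁ T₂} → V₁ →₀ V₂ → T₁ →₀ T₂ →
          appl V₁ (𝛌 W T₁) →₀ 𝛅 V₂ T₂
  -- x is index 0 inside the body; V₂ is weakened to live under the binder
  δ     : ∀ {V₁ V₂ T₁ T₂ T} → V₁ →₀ V₂ → T₁ →₀ T₂ →
          StrictSubst 0 (shift 1 0 V₂) T₂ T → 𝛅 V₁ T₁ →₀ 𝛅 V₂ T
  -- x ∉ FV(T₁): the body is the weakening of a term T₁ not under the binder
  ζ     : ∀ {V T₁ T₂} → T₁ →₀ T₂ → 𝛅 V (shift 1 0 T₁) →₀ T₂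
  τ     : ∀ {W T₁ T₂} → T₁ →₀ T₂ → cast W T₁ →₀ T₂
  υ     : ∀ {V₁ V₂ V₃ V₄ T₁ T₂} → V₁ →₀ V₃ → V₂ →₀ V₄ → T₁ →₀ T₂ →
          appl V₁ (𝛅 V₂ T₁) →₀ 𝛅 V₄ (appl (shift 1 0 V₃) T₂)

-- Environments (same grammar as in the paper, terminal sort innermost)

data Env : Set where
  ⋆    : ℕ → Env
  𝛌    : Term → Env → Env
  𝛅    : Term → Env → Env
  appl : Term → Env → Env
  cast : Term → Env → Env

infixr 5 _·_
_·_ : Env → Env → Env
⋆ h      · C₂ = C₂
𝛌 W C    · C₂ = 𝛌 W (C · C₂)
𝛅 V C    · C₂ = 𝛅 V (C · C₂)
appl V C · C₂ = appl V (C · C₂)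
cast W C · C₂ = cast W (C · C₂)

top : Env → ℕ
top (⋆ h)      = h
top (𝛌 _ C)    = top C
top (𝛅 _ C)    = top C
top (appl _ C) = top C
top (cast _ C) = top C

_∙𝛌_ : Env → Term → Env
E ∙𝛌 W = E · 𝛌 W (⋆ (top E))

_∙𝛅_ : Env → Term → Env
E ∙𝛅 V = E · 𝛅 V (⋆ (top E))

binders : Env → ℕ
binders (⋆ _)      = 0
binders (𝛌 _ C)    = suc (binders C)
binders (𝛅 _ C)    = suc (binders C)
binders (appl _ C) = binders C
binders (cast _ C) = binders C

-- In E = C₁ · β · C₂ the variable bound by β has index  binders C₂  in E,
-- and a term living in C₁ is weakened by  suc (binders C₂)  to live in E.

infix 4 _⊢_⇒_ _⊢_⇒*_ _⊢_⇔_
data _⊢_⇒_ (E : Env) : Term → Term → Set where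
  free  : ∀ {T₁ T₂} → T₁ →₀ T₂ → E ⊢ T₁ ⇒ T₂
  delta : ∀ {T₁ T′ T₂} (C₁ : Env) (V : Term) (C₂ : Env) →
          E ≡ C₁ · 𝛅 V C₂ → T₁ →₀ T′ →
          StrictSubst (binders C₂) (shift (suc (binders C₂)) 0 V) T′ T₂ →
          E ⊢ T₁ ⇒ T₂

_⊢_⇒*_ : Env → Term → Term → Set
E ⊢ T₁ ⇒* T₂ = TransClosure (E ⊢_⇒_) T₁ T₂

_⊢_⇔_ : Env → Term → Term → Set
E ⊢ T₁ ⇔ T₂ = TransClosure (SymClosure (E ⊢_⇒_)) T₁ T₂

data NType (g : ℕ → ℕ) : Env → Term → Term → Set where
  sort : ∀ {E h} → NType g E (⋆ h) (⋆ (g h))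
  def  : ∀ {E V W} (C₁ C₂ : Env) → E ≡ C₁ · 𝛅 V C₂ → NType g C₁ V W →
         NType g E (# (binders C₂)) (shift (suc (binders C₂)) 0 W)
  decl : ∀ {E V W} (C₁ C₂ : Env) → E ≡ C₁ · 𝛌 W C₂ → NType g C₁ W V →
         NType g E (# (binders C₂)) (shift (suc (binders C₂)) 0 W)
  abbr : ∀ {E V W T U} → NType g E V W → NType g (E ∙𝛅 V) T U →
         NType g E (𝛅 V T) (𝛅 V U)
  abst : ∀ {E V W T U} → NType g E W V → NType g (E ∙𝛌 W) T U →
         NType g E (𝛌 W T) (𝛌 W U)
  appl : ∀ {E V W T U} → NType g E V W → NType g E T (𝛌 W U) →
         NType g E (appl V T) (appl V (𝛌 W U))
  cast : ∀ {E T W V} → NType g E T W → NType g E W V →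
         NType g E (cast W T) (cast V W)
  conv : ∀ {E T U₁ U₂ W} → NType g E U₂ W → NType g E T U₁ →
         E ⊢ U₁ ⇔ U₂ → NType g E T U₂

syntax NType g E T U = E ⊢[ g ] T ∶ U

-- Validity makes the type T₁ typable, subject reduction carries this to T₂, and
-- the conversion rule retypes T at T₂ because T₁ ⇒* T₂ is a conversion.
--
-- Subject reduction is proved for list contexts, where conversion is
-- characterised by δ-normal forms: unfold every abbreviation of the context
-- and of the two terms, and ask for a common reduct under parallel β/τ
-- reduction with genuine substitution, which is confluent by the
-- Tait–Martin-Löf complete development.  This gives injectivity of λ for the
-- β-case; the other cases follow from one substitution lemma along context
-- morphisms, instantiated to weakening, to the elimination of an abbreviation
-- (ζ), to turning a declaration into an abbreviation (β), and to replacing an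
-- item by a convertible one.  Unfolding shows that the characterisation agrees
-- with the conversion of the paper.

module Submission where

open import Defs
open import Data.Bool using (true; false; _∨_; if_then_else_; T)
open import Data.List using (List; []; _∷_; _++_; length)
open import Data.List.Properties using (++-assoc; ++-identityʳ; length-++)
open import Data.Nat using (ℕ; zero; suc; pred; _+_; _<_; _≤_; _<ᵇ_; _≡ᵇ_; s≤s⁻¹)
open import Data.Nat.Properties
  using (+-comm; +-assoc; +-suc; +-identityʳ; ≤-trans; ≤-refl; ≤-reflexive; +-mono-≤; m≤m+n; m≤n+m;
         ≡ᵇ⇒≡; m≢1+m+n)
open import Data.Product using (∃-syntax; _×_; _,_; proj₁; proj₂)
open import Data.Sum using (_⊎_; inj₁; inj₂)
open import Data.Unit using (tt)
open import Function using (_∘_; id)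
open import Level using (0ℓ)
open import Relation.Nullary using (¬_)
open import Relation.Binary.Bundles using (Setoid)
open import Relation.Binary.PropositionalEquality
  using (_≡_; refl; sym; trans; cong; cong₂; subst₂; _≗_; module ≡-Reasoning)
  renaming (subst to ≡-subst)
import Relation.Binary.Reasoning.Setoid
open import Relation.Binary.Rewriting using (Confluent)
open import Relation.Binary.Construct.Closure.ReflexiveTransitive using (Star; ε; _◅_; _◅◅_; gmap; concat)
open import Relation.Binary.Construct.Closure.Equivalence using (EqClosure; symmetric)
open import Relation.Binary.Construct.Closure.Symmetric using (fwd)
import Relation.Binary.Construct.Closure.Symmetric as SymClosure
open import Relation.Binary.Construct.Closure.Transitive using ([_]; _∷_)

-- Renaming, substitution and δ-expansion

Ren : Set
Ren = ℕ → ℕ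

Subst : Set
Subst = ℕ → Term

ext : Ren → Ren
ext ρ zero    = zero
ext ρ (suc i) = suc (ρ i)

rename : Ren → Term → Term
rename ρ (⋆ h)      = ⋆ h
rename ρ (# i)      = # (ρ i)
rename ρ (𝛌 W T)    = 𝛌 (rename ρ W) (rename (ext ρ) T)
rename ρ (𝛅 V T)    = 𝛅 (rename ρ V) (rename (ext ρ) T)
rename ρ (appl V T) = appl (rename ρ V) (rename ρ T)
rename ρ (cast W T) = cast (rename ρ W) (rename ρ T)

infixr 5 _•_
_•_ : Term → Subst → Subst
(X • σ) zero    = X
(X • σ) (suc i) = σ i

exts : Subst → Subst
exts σ = # 0 • (rename suc ∘ σ)

subst : Subst → Term → Term
subst σ (⋆ h)      = ⋆ h
subst σ (# i)      = σ i
subst σ (𝛌 W T)    = 𝛌 (subst σ W) (subst (exts σ) T)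
subst σ (𝛅 V T)    = 𝛅 (subst σ V) (subst (exts σ) T)
subst σ (appl V T) = appl (subst σ V) (subst σ T)
subst σ (cast W T) = cast (subst σ W) (subst σ T)

expand : Subst → Term → Term
expand σ (⋆ h)      = ⋆ h
expand σ (# i)      = σ i
expand σ (𝛌 W T)    = 𝛌 (expand σ W) (expand (exts σ) T)
expand σ (𝛅 V T)    = expand (expand σ V • σ) T
expand σ (appl V T) = appl (expand σ V) (expand σ T)
expand σ (cast W T) = cast (expand σ W) (expand σ T)

ext-cong : ∀ {ρ ρ′} → ρ ≗ ρ′ → ext ρ ≗ ext ρ′
ext-cong e zero    = refl
ext-cong e (suc i) = cong suc (e i)

rename-cong : ∀ {ρ ρ′} → ρ ≗ ρ′ → rename ρ ≗ rename ρ′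
rename-cong e (⋆ h)      = refl
rename-cong e (# i)      = cong # (e i)
rename-cong e (𝛌 W T)    = cong₂ 𝛌 (rename-cong e W) (rename-cong (ext-cong e) T)
rename-cong e (𝛅 V T)    = cong₂ 𝛅 (rename-cong e V) (rename-cong (ext-cong e) T)
rename-cong e (appl V T) = cong₂ appl (rename-cong e V) (rename-cong e T)
rename-cong e (cast W T) = cong₂ cast (rename-cong e W) (rename-cong e T)

•-cong : ∀ {X Y σ σ′} → X ≡ Y → σ ≗ σ′ → X • σ ≗ Y • σ′
•-cong p e zero    = p
•-cong p e (suc i) = e i

map-• : ∀ (f : Term → Term) {X Y} σ → f X ≡ Y → f ∘ (X • σ) ≗ Y • (f ∘ σ)
map-• f σ p zero    = p
map-• f σ p (suc i) = refl

exts-cong : ∀ {σ σ′} → σ ≗ σ′ → exts σ ≗ exts σ′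
exts-cong e = •-cong refl (cong (rename suc) ∘ e)

subst-cong : ∀ {σ σ′} → σ ≗ σ′ → subst σ ≗ subst σ′
subst-cong e (⋆ h)      = refl
subst-cong e (# i)      = e i
subst-cong e (𝛌 W T)    = cong₂ 𝛌 (subst-cong e W) (subst-cong (exts-cong e) T)
subst-cong e (𝛅 V T)    = cong₂ 𝛅 (subst-cong e V) (subst-cong (exts-cong e) T)
subst-cong e (appl V T) = cong₂ appl (subst-cong e V) (subst-cong e T)
subst-cong e (cast W T) = cong₂ cast (subst-cong e W) (subst-cong e T)

expand-cong : ∀ {σ σ′} → σ ≗ σ′ → expand σ ≗ expand σ′
expand-cong e (⋆ h)      = refl
expand-cong e (# i)      = e i
expand-cong e (𝛌 W T)    = cong₂ 𝛌 (expand-cong e W) (expand-cong (exts-cong e) T)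
expand-cong e (𝛅 V T)    = expand-cong (•-cong (expand-cong e V) e) T
expand-cong e (appl V T) = cong₂ appl (expand-cong e V) (expand-cong e T)
expand-cong e (cast W T) = cong₂ cast (expand-cong e W) (expand-cong e T)

ext-∘ : ∀ ρ ρ′ → ext ρ ∘ ext ρ′ ≗ ext (ρ ∘ ρ′)
ext-∘ ρ ρ′ zero    = refl
ext-∘ ρ ρ′ (suc i) = refl

rename-rename : ∀ ρ ρ′ T → rename ρ (rename ρ′ T) ≡ rename (ρ ∘ ρ′) T
rename-rename ρ ρ′ (⋆ h)      = refl
rename-rename ρ ρ′ (# i)      = refl
rename-rename ρ ρ′ (𝛌 W T)    =
  cong₂ 𝛌 (rename-rename ρ ρ′ W) (trans (rename-rename (ext ρ) (ext ρ′) T) (rename-cong (ext-∘ ρ ρ′) T))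
rename-rename ρ ρ′ (𝛅 V T)    =
  cong₂ 𝛅 (rename-rename ρ ρ′ V) (trans (rename-rename (ext ρ) (ext ρ′) T) (rename-cong (ext-∘ ρ ρ′) T))
rename-rename ρ ρ′ (appl V T) = cong₂ appl (rename-rename ρ ρ′ V) (rename-rename ρ ρ′ T)
rename-rename ρ ρ′ (cast W T) = cong₂ cast (rename-rename ρ ρ′ W) (rename-rename ρ ρ′ T)

ext-id : ext id ≗ id
ext-id zero    = refl
ext-id (suc i) = refl

rename-id : ∀ T → rename id T ≡ T
rename-id (⋆ h)      = refl
rename-id (# i)      = refl
rename-id (𝛌 W T)    = cong₂ 𝛌 (rename-id W) (trans (rename-cong ext-id T) (rename-id T))
rename-id (𝛅 V T)    = cong₂ 𝛅 (rename-id V) (trans (rename-cong ext-id T) (rename-id T))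
rename-id (appl V T) = cong₂ appl (rename-id V) (rename-id T)
rename-id (cast W T) = cong₂ cast (rename-id W) (rename-id T)

exts-ext : ∀ σ ρ → exts σ ∘ ext ρ ≗ exts (σ ∘ ρ)
exts-ext σ ρ zero    = refl
exts-ext σ ρ (suc i) = refl

subst-rename : ∀ σ ρ T → subst σ (rename ρ T) ≡ subst (σ ∘ ρ) T
subst-rename σ ρ (⋆ h)      = refl
subst-rename σ ρ (# i)      = refl
subst-rename σ ρ (𝛌 W T)    =
  cong₂ 𝛌 (subst-rename σ ρ W) (trans (subst-rename (exts σ) (ext ρ) T) (subst-cong (exts-ext σ ρ) T))
subst-rename σ ρ (𝛅 V T)    =
  cong₂ 𝛅 (subst-rename σ ρ V) (trans (subst-rename (exts σ) (ext ρ) T) (subst-cong (exts-ext σ ρ) T))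
subst-rename σ ρ (appl V T) = cong₂ appl (subst-rename σ ρ V) (subst-rename σ ρ T)
subst-rename σ ρ (cast W T) = cong₂ cast (subst-rename σ ρ W) (subst-rename σ ρ T)

rename-exts : ∀ ρ σ → rename (ext ρ) ∘ exts σ ≗ exts (rename ρ ∘ σ)
rename-exts ρ σ zero    = refl
rename-exts ρ σ (suc i) =
  trans (rename-rename (ext ρ) suc (σ i)) (sym (rename-rename suc ρ (σ i)))

rename-subst : ∀ ρ σ T → rename ρ (subst σ T) ≡ subst (rename ρ ∘ σ) T
rename-subst ρ σ (⋆ h)      = refl
rename-subst ρ σ (# i)      = refl
rename-subst ρ σ (𝛌 W T)    =
  cong₂ 𝛌 (rename-subst ρ σ W) (trans (rename-subst (ext ρ) (exts σ) T) (subst-cong (rename-exts ρ σ) T))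
rename-subst ρ σ (𝛅 V T)    =
  cong₂ 𝛅 (rename-subst ρ σ V) (trans (rename-subst (ext ρ) (exts σ) T) (subst-cong (rename-exts ρ σ) T))
rename-subst ρ σ (appl V T) = cong₂ appl (rename-subst ρ σ V) (rename-subst ρ σ T)
rename-subst ρ σ (cast W T) = cong₂ cast (rename-subst ρ σ W) (rename-subst ρ σ T)

subst-exts : ∀ θ σ → subst (exts θ) ∘ exts σ ≗ exts (subst θ ∘ σ)
subst-exts θ σ zero    = refl
subst-exts θ σ (suc i) =
  trans (subst-rename (exts θ) suc (σ i)) (sym (rename-subst suc θ (σ i)))

subst-subst : ∀ θ σ T → subst θ (subst σ T) ≡ subst (subst θ ∘ σ) T
subst-subst θ σ (⋆ h)      = refl
subst-subst θ σ (# i)      = refl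
subst-subst θ σ (𝛌 W T)    =
  cong₂ 𝛌 (subst-subst θ σ W) (trans (subst-subst (exts θ) (exts σ) T) (subst-cong (subst-exts θ σ) T))
subst-subst θ σ (𝛅 V T)    =
  cong₂ 𝛅 (subst-subst θ σ V) (trans (subst-subst (exts θ) (exts σ) T) (subst-cong (subst-exts θ σ) T))
subst-subst θ σ (appl V T) = cong₂ appl (subst-subst θ σ V) (subst-subst θ σ T)
subst-subst θ σ (cast W T) = cong₂ cast (subst-subst θ σ W) (subst-subst θ σ T)

exts-# : ∀ ρ → exts (# ∘ ρ) ≗ # ∘ ext ρ
exts-# ρ zero    = refl
exts-# ρ (suc i) = refl

subst-# : ∀ ρ T → subst (# ∘ ρ) T ≡ rename ρ T
subst-# ρ (⋆ h)      = refl
subst-# ρ (# i)      = refl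
subst-# ρ (𝛌 W T)    = cong₂ 𝛌 (subst-# ρ W) (trans (subst-cong (exts-# ρ) T) (subst-# (ext ρ) T))
subst-# ρ (𝛅 V T)    = cong₂ 𝛅 (subst-# ρ V) (trans (subst-cong (exts-# ρ) T) (subst-# (ext ρ) T))
subst-# ρ (appl V T) = cong₂ appl (subst-# ρ V) (subst-# ρ T)
subst-# ρ (cast W T) = cong₂ cast (subst-# ρ W) (subst-# ρ T)

subst-id : ∀ T → subst # T ≡ T
subst-id T = trans (subst-# id T) (rename-id T)

expand-rename : ∀ σ ρ T → expand σ (rename ρ T) ≡ expand (σ ∘ ρ) T
expand-rename σ ρ (⋆ h)      = refl
expand-rename σ ρ (# i)      = refl
expand-rename σ ρ (𝛌 W T)    =
  cong₂ 𝛌 (expand-rename σ ρ W) (trans (expand-rename (exts σ) (ext ρ) T) (expand-cong (exts-ext σ ρ) T))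
expand-rename σ ρ (𝛅 V T)    =
  trans (expand-rename (expand σ (rename ρ V) • σ) (ext ρ) T) (expand-cong (•-ext (expand-rename σ ρ V)) T)
  where •-ext : ∀ {X Y} → X ≡ Y → (X • σ) ∘ ext ρ ≗ Y • (σ ∘ ρ)
        •-ext p zero    = p
        •-ext p (suc i) = refl
expand-rename σ ρ (appl V T) = cong₂ appl (expand-rename σ ρ V) (expand-rename σ ρ T)
expand-rename σ ρ (cast W T) = cong₂ cast (expand-rename σ ρ W) (expand-rename σ ρ T)

rename-expand : ∀ ρ σ T → rename ρ (expand σ T) ≡ expand (rename ρ ∘ σ) T
rename-expand ρ σ (⋆ h)      = refl
rename-expand ρ σ (# i)      = refl
rename-expand ρ σ (𝛌 W T)    =
  cong₂ 𝛌 (rename-expand ρ σ W) (trans (rename-expand (ext ρ) (exts σ) T) (expand-cong (rename-exts ρ σ) T))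
rename-expand ρ σ (𝛅 V T)    =
  trans (rename-expand ρ (expand σ V • σ) T) (expand-cong (map-• (rename ρ) σ (rename-expand ρ σ V)) T)
rename-expand ρ σ (appl V T) = cong₂ appl (rename-expand ρ σ V) (rename-expand ρ σ T)
rename-expand ρ σ (cast W T) = cong₂ cast (rename-expand ρ σ W) (rename-expand ρ σ T)

expand-exts : ∀ σ θ → expand (exts σ) ∘ exts θ ≗ exts (expand σ ∘ θ)
expand-exts σ θ zero    = refl
expand-exts σ θ (suc i) =
  trans (expand-rename (exts σ) suc (θ i)) (sym (rename-expand suc σ (θ i)))

expand-subst : ∀ σ θ T → expand σ (subst θ T) ≡ expand (expand σ ∘ θ) T
expand-subst σ θ (⋆ h)      = refl
expand-subst σ θ (# i)      = refl
expand-subst σ θ (𝛌 W T)    =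
  cong₂ 𝛌 (expand-subst σ θ W) (trans (expand-subst (exts σ) (exts θ) T) (expand-cong (expand-exts σ θ) T))
expand-subst σ θ (𝛅 V T)    =
  trans (expand-subst (expand σ (subst θ V) • σ) (exts θ) T) (expand-cong •-exts T)
  where •-exts : expand (expand σ (subst θ V) • σ) ∘ exts θ ≗ expand (expand σ ∘ θ) V • (expand σ ∘ θ)
        •-exts zero    = expand-subst σ θ V
        •-exts (suc i) = expand-rename _ suc (θ i)
expand-subst σ θ (appl V T) = cong₂ appl (expand-subst σ θ V) (expand-subst σ θ T)
expand-subst σ θ (cast W T) = cong₂ cast (expand-subst σ θ W) (expand-subst σ θ T)

subst-expand : ∀ θ σ T → subst θ (expand σ T) ≡ expand (subst θ ∘ σ) T
subst-expand θ σ (⋆ h)      = refl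
subst-expand θ σ (# i)      = refl
subst-expand θ σ (𝛌 W T)    =
  cong₂ 𝛌 (subst-expand θ σ W) (trans (subst-expand (exts θ) (exts σ) T) (expand-cong (subst-exts θ σ) T))
subst-expand θ σ (𝛅 V T)    =
  trans (subst-expand θ (expand σ V • σ) T) (expand-cong (map-• (subst θ) σ (subst-expand θ σ V)) T)
subst-expand θ σ (appl V T) = cong₂ appl (subst-expand θ σ V) (subst-expand θ σ T)
subst-expand θ σ (cast W T) = cong₂ cast (subst-expand θ σ W) (subst-expand θ σ T)

shiftVar : ℕ → ℕ → Ren
shiftVar d c i = if i <ᵇ c then i else i + d

ext-shiftVar : ∀ d c → ext (shiftVar d c) ≗ shiftVar d (suc c)
ext-shiftVar d c zero    = refl
ext-shiftVar d c (suc i) with i <ᵇ c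
... | true  = refl
... | false = refl

shift-rename : ∀ d c T → shift d c T ≡ rename (shiftVar d c) T
shift-rename d c (⋆ h)      = refl
shift-rename d c (# i) with i <ᵇ c
... | true  = refl
... | false = refl
shift-rename d c (𝛌 W T)    = cong₂ 𝛌 (shift-rename d c W)
  (trans (shift-rename d (suc c) T) (sym (rename-cong (ext-shiftVar d c) T)))
shift-rename d c (𝛅 V T)    = cong₂ 𝛅 (shift-rename d c V)
  (trans (shift-rename d (suc c) T) (sym (rename-cong (ext-shiftVar d c) T)))
shift-rename d c (appl V T) = cong₂ appl (shift-rename d c V) (shift-rename d c T)
shift-rename d c (cast W T) = cong₂ cast (shift-rename d c W) (shift-rename d c T)

shift₀ : ∀ d T → shift d 0 T ≡ rename (d +_) T
shift₀ d T = trans (shift-rename d 0 T) (rename-cong (λ i → +-comm i d) T)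

shift-shift : ∀ n T → shift 1 0 (shift n 0 T) ≡ shift (suc n) 0 T
shift-shift n T = begin
  shift 1 0 (shift n 0 T)        ≡⟨ shift₀ 1 _ ⟩
  rename suc (shift n 0 T)       ≡⟨ cong (rename suc) (shift₀ n T) ⟩
  rename suc (rename (n +_) T)   ≡⟨ rename-rename suc (n +_) T ⟩
  rename (suc n +_) T            ≡⟨ shift₀ (suc n) T ⟨
  shift (suc n) 0 T              ∎
  where open ≡-Reasoning

-- Parallel β/τ-reduction, confluence and joinability

infix 6 _[_]₀
_[_]₀ : Term → Term → Term
T [ V ]₀ = subst (V • #) T

infix 4 _⇛_ _⇛*_ _↓_
data _⇛_ : Term → Term → Set where
  sort : ∀ {h} → ⋆ h ⇛ ⋆ h
  var  : ∀ {i} → # i ⇛ # i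
  𝛌    : ∀ {W W′ T T′} → W ⇛ W′ → T ⇛ T′ → 𝛌 W T ⇛ 𝛌 W′ T′
  𝛅    : ∀ {V V′ T T′} → V ⇛ V′ → T ⇛ T′ → 𝛅 V T ⇛ 𝛅 V′ T′
  appl : ∀ {V V′ T T′} → V ⇛ V′ → T ⇛ T′ → appl V T ⇛ appl V′ T′
  cast : ∀ {W W′ T T′} → W ⇛ W′ → T ⇛ T′ → cast W T ⇛ cast W′ T′
  β    : ∀ {V V′ W T T′} → V ⇛ V′ → T ⇛ T′ → appl V (𝛌 W T) ⇛ T′ [ V′ ]₀
  τ    : ∀ {W T T′} → T ⇛ T′ → cast W T ⇛ T′

_⇛*_ : Term → Term → Set
_⇛*_ = Star _⇛_

⇛-refl : ∀ T → T ⇛ T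
⇛-refl (⋆ h)      = sort
⇛-refl (# i)      = var
⇛-refl (𝛌 W T)    = 𝛌 (⇛-refl W) (⇛-refl T)
⇛-refl (𝛅 V T)    = 𝛅 (⇛-refl V) (⇛-refl T)
⇛-refl (appl V T) = appl (⇛-refl V) (⇛-refl T)
⇛-refl (cast W T) = cast (⇛-refl W) (⇛-refl T)

rename-[]₀ : ∀ ρ T V → rename ρ (T [ V ]₀) ≡ rename (ext ρ) T [ rename ρ V ]₀
rename-[]₀ ρ T V = begin
  rename ρ (subst (V • #) T)                   ≡⟨ rename-subst ρ (V • #) T ⟩
  subst (rename ρ ∘ (V • #)) T                 ≡⟨ subst-cong rename-• T ⟩
  subst ((rename ρ V • #) ∘ ext ρ) T           ≡⟨ subst-rename (rename ρ V • #) (ext ρ) T ⟨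
  subst (rename ρ V • #) (rename (ext ρ) T)    ∎
  where open ≡-Reasoning
        rename-• : rename ρ ∘ (V • #) ≗ (rename ρ V • #) ∘ ext ρ
        rename-• zero    = refl
        rename-• (suc i) = refl

subst-[]₀ : ∀ σ T V → subst σ (T [ V ]₀) ≡ subst (exts σ) T [ subst σ V ]₀
subst-[]₀ σ T V = begin
  subst σ (subst (V • #) T)                    ≡⟨ subst-subst σ (V • #) T ⟩
  subst (subst σ ∘ (V • #)) T                  ≡⟨ subst-cong (map-• (subst σ) # refl) T ⟩
  subst (subst σ V • σ) T                      ≡⟨ subst-cong •-exts T ⟩
  subst (subst (subst σ V • #) ∘ exts σ) T     ≡⟨ subst-subst (subst σ V • #) (exts σ) T ⟨
  subst (subst σ V • #) (subst (exts σ) T)     ∎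
  where open ≡-Reasoning
        •-exts : subst σ V • σ ≗ subst (subst σ V • #) ∘ exts σ
        •-exts zero    = refl
        •-exts (suc i) = sym (trans (subst-rename _ suc (σ i)) (subst-id (σ i)))

rename-⇛ : ∀ ρ {T T′} → T ⇛ T′ → rename ρ T ⇛ rename ρ T′
rename-⇛ ρ sort       = sort
rename-⇛ ρ var        = var
rename-⇛ ρ (𝛌 a b)    = 𝛌 (rename-⇛ ρ a) (rename-⇛ (ext ρ) b)
rename-⇛ ρ (𝛅 a b)    = 𝛅 (rename-⇛ ρ a) (rename-⇛ (ext ρ) b)
rename-⇛ ρ (appl a b) = appl (rename-⇛ ρ a) (rename-⇛ ρ b)
rename-⇛ ρ (cast a b) = cast (rename-⇛ ρ a) (rename-⇛ ρ b)
rename-⇛ ρ (β {V′ = V′} {T′ = T′} a b) =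
  ≡-subst (_ ⇛_) (sym (rename-[]₀ ρ T′ V′)) (β (rename-⇛ ρ a) (rename-⇛ (ext ρ) b))
rename-⇛ ρ (τ a)      = τ (rename-⇛ ρ a)

infix 4 _⇛ˢ_
_⇛ˢ_ : Subst → Subst → Set
σ ⇛ˢ σ′ = ∀ i → σ i ⇛ σ′ i

exts-⇛ : ∀ {σ σ′} → σ ⇛ˢ σ′ → exts σ ⇛ˢ exts σ′
exts-⇛ s zero    = var
exts-⇛ s (suc i) = rename-⇛ suc (s i)

•-⇛ : ∀ {V V′ σ σ′} → V ⇛ V′ → σ ⇛ˢ σ′ → V • σ ⇛ˢ V′ • σ′
•-⇛ a s zero    = a
•-⇛ a s (suc i) = s i

subst-⇛ : ∀ {σ σ′} → σ ⇛ˢ σ′ → ∀ {T T′} → T ⇛ T′ → subst σ T ⇛ subst σ′ T′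
subst-⇛ s sort       = sort
subst-⇛ s (var {i})  = s i
subst-⇛ s (𝛌 a b)    = 𝛌 (subst-⇛ s a) (subst-⇛ (exts-⇛ s) b)
subst-⇛ s (𝛅 a b)    = 𝛅 (subst-⇛ s a) (subst-⇛ (exts-⇛ s) b)
subst-⇛ s (appl a b) = appl (subst-⇛ s a) (subst-⇛ s b)
subst-⇛ s (cast a b) = cast (subst-⇛ s a) (subst-⇛ s b)
subst-⇛ {σ′ = σ′} s (β {V′ = V′} {T′ = T′} a b) =
  ≡-subst (_ ⇛_) (sym (subst-[]₀ σ′ T′ V′)) (β (subst-⇛ s a) (subst-⇛ (exts-⇛ s) b))
subst-⇛ s (τ a)      = τ (subst-⇛ s a)

mutual
  develop : Term → Term
  develop (⋆ h)      = ⋆ h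
  develop (# i)      = # i
  develop (𝛌 W T)    = 𝛌 (develop W) (develop T)
  develop (𝛅 V T)    = 𝛅 (develop V) (develop T)
  develop (appl V T) = develop-appl (develop V) T
  develop (cast W T) = develop T

  develop-appl : Term → Term → Term
  develop-appl V′ (𝛌 W T) = develop T [ V′ ]₀
  develop-appl V′ T       = appl V′ (develop T)

mutual
  ⇛-develop : ∀ {T T′} → T ⇛ T′ → T′ ⇛ develop T
  ⇛-develop sort       = sort
  ⇛-develop var        = var
  ⇛-develop (𝛌 a b)    = 𝛌 (⇛-develop a) (⇛-develop b)
  ⇛-develop (𝛅 a b)    = 𝛅 (⇛-develop a) (⇛-develop b)
  ⇛-develop (appl a b) = ⇛-develop-appl (⇛-develop a) b
  ⇛-develop (cast a b) = τ (⇛-develop b)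
  ⇛-develop (β a b)    = subst-⇛ (•-⇛ (⇛-develop a) (λ _ → var)) (⇛-develop b)
  ⇛-develop (τ a)      = ⇛-develop a

  ⇛-develop-appl : ∀ {V′ V″ T T′} → V′ ⇛ V″ → T ⇛ T′ → appl V′ T′ ⇛ develop-appl V″ T
  -- One clause per head of T, so that develop-appl V″ T computes in each.
  ⇛-develop-appl a (𝛌 b c)      = β a (⇛-develop c)
  ⇛-develop-appl a b@sort       = appl a (⇛-develop b)
  ⇛-develop-appl a b@var        = appl a (⇛-develop b)
  ⇛-develop-appl a b@(𝛅 _ _)    = appl a (⇛-develop b)
  ⇛-develop-appl a b@(appl _ _) = appl a (⇛-develop b)
  ⇛-develop-appl a b@(cast _ _) = appl a (⇛-develop b)
  ⇛-develop-appl a b@(β _ _)    = appl a (⇛-develop b)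
  ⇛-develop-appl a b@(τ _)      = appl a (⇛-develop b)

⇛-strip : ∀ {A B C} → A ⇛ B → A ⇛* C → ∃[ D ] (B ⇛* D × C ⇛ D)
⇛-strip r ε = _ , ε , r
⇛-strip r (s ◅ p) with ⇛-strip (⇛-develop s) p
... | D , q , t = D , ⇛-develop r ◅ q , t

⇛-confluent : Confluent _⇛_
⇛-confluent ε       q = _ , q , ε
⇛-confluent (r ◅ p) q with ⇛-strip r q
... | _ , q′ , t with ⇛-confluent p q′
... | E , u , v = E , u , t ◅ v

_↓_ : Term → Term → Set
A ↓ B = ∃[ C ] (A ⇛* C × B ⇛* C)

↓-refl : ∀ {A} → A ↓ A
↓-refl = _ , ε , ε

↓-reflexive : ∀ {A B} → A ≡ B → A ↓ B
↓-reflexive refl = ↓-refl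

↓-sym : ∀ {A B} → A ↓ B → B ↓ A
↓-sym (C , p , q) = C , q , p

↓-trans : ∀ {A B C} → A ↓ B → B ↓ C → A ↓ C
↓-trans (_ , p , q) (_ , r , s) with ⇛-confluent q r
... | F , u , v = F , p ◅◅ u , s ◅◅ v

↓-setoid : Setoid 0ℓ 0ℓ
↓-setoid = record
  { Carrier       = Term
  ; _≈_           = _↓_
  ; isEquivalence = record { refl = ↓-refl ; sym = ↓-sym ; trans = ↓-trans }
  }

module ↓-Reasoning = Relation.Binary.Reasoning.Setoid ↓-setoid

⇛⇒↓ : ∀ {A B} → A ⇛ B → A ↓ B
⇛⇒↓ r = _ , r ◅ ε , ε

Star-cong₂ : ∀ {_R_ : Term → Term → Set} → (∀ {a} → a R a) →
             (f : Term → Term → Term) → (∀ {a a′ b b′} → a R a′ → b R b′ → f a b R f a′ b′) →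
             ∀ {a a′ b b′} → Star _R_ a a′ → Star _R_ b b′ → Star _R_ (f a b) (f a′ b′)
Star-cong₂ R-refl f c {a′ = a′} {b = b} p q =
  gmap (λ x → f x b) (λ r → c r R-refl) p ◅◅ gmap (f a′) (c R-refl) q

↓-cong₂ : (f : Term → Term → Term) → (∀ {a a′ b b′} → a ⇛ a′ → b ⇛ b′ → f a b ⇛ f a′ b′) →
          ∀ {a a′ b b′} → a ↓ a′ → b ↓ b′ → f a b ↓ f a′ b′
↓-cong₂ f c (C , p , q) (D , r , s) = f C D , Star-cong₂ (⇛-refl _) f c p r , Star-cong₂ (⇛-refl _) f c q s

↓-𝛌 : ∀ {a a′ b b′} → a ↓ a′ → b ↓ b′ → 𝛌 a b ↓ 𝛌 a′ b′
↓-𝛌 = ↓-cong₂ 𝛌 𝛌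

↓-appl : ∀ {a a′ b b′} → a ↓ a′ → b ↓ b′ → appl a b ↓ appl a′ b′
↓-appl = ↓-cong₂ appl appl

↓-cast : ∀ {a a′ b b′} → a ↓ a′ → b ↓ b′ → cast a b ↓ cast a′ b′
↓-cast = ↓-cong₂ cast cast

↓-rename : ∀ ρ {A B} → A ↓ B → rename ρ A ↓ rename ρ B
↓-rename ρ (C , p , q) = rename ρ C , gmap (rename ρ) (rename-⇛ ρ) p , gmap (rename ρ) (rename-⇛ ρ) q

↓-subst : ∀ σ {A B} → A ↓ B → subst σ A ↓ subst σ B
↓-subst σ (C , p , q) = subst σ C , gmap (subst σ) subst-refl-⇛ p , gmap (subst σ) subst-refl-⇛ q
  where subst-refl-⇛ : ∀ {T T′} → T ⇛ T′ → subst σ T ⇛ subst σ T′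
        subst-refl-⇛ = subst-⇛ (⇛-refl ∘ σ)

infix 4 _↓ˢ_
_↓ˢ_ : Subst → Subst → Set
σ ↓ˢ σ′ = ∀ i → σ i ↓ σ′ i

expand-↓ : ∀ {σ σ′} → σ ↓ˢ σ′ → ∀ T → expand σ T ↓ expand σ′ T
expand-↓ e (⋆ h)      = ↓-refl
expand-↓ e (# i)      = e i
expand-↓ e (𝛌 W T)    = ↓-𝛌 (expand-↓ e W) (expand-↓ (exts-↓ e) T)
  where exts-↓ : ∀ {σ σ′} → σ ↓ˢ σ′ → exts σ ↓ˢ exts σ′
        exts-↓ e zero    = ↓-refl
        exts-↓ e (suc i) = ↓-rename suc (e i)
expand-↓ e (𝛅 V T)    = expand-↓ (•-↓ (expand-↓ e V)) T
  where •-↓ : ∀ {X Y} → X ↓ Y → X • _ ↓ˢ Y • _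
        •-↓ p zero    = p
        •-↓ p (suc i) = e i
expand-↓ e (appl V T) = ↓-appl (expand-↓ e V) (expand-↓ e T)
expand-↓ e (cast W T) = ↓-cast (expand-↓ e W) (expand-↓ e T)

𝛌-⇛*-inv : ∀ {W T R} → 𝛌 W T ⇛* R → ∃[ W′ ] ∃[ T′ ] (R ≡ 𝛌 W′ T′ × W ⇛* W′ × T ⇛* T′)
𝛌-⇛*-inv ε = _ , _ , refl , ε , ε
𝛌-⇛*-inv (𝛌 a b ◅ p) with 𝛌-⇛*-inv p
... | W′ , T′ , e , q , r = W′ , T′ , e , a ◅ q , b ◅ r

𝛌-↓-inj : ∀ {W T W′ T′} → 𝛌 W T ↓ 𝛌 W′ T′ → W ↓ W′ × T ↓ T′
𝛌-↓-inj (_ , p , q) with 𝛌-⇛*-inv p | 𝛌-⇛*-inv q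
... | A , B , refl , p₁ , p₂ | _ , _ , refl , q₁ , q₂ = (A , p₁ , q₁) , (B , p₂ , q₂)

-- Contexts, δ-normal forms and conversion

data Item : Set where
  Iλ : Term → Item
  Iδ : Term → Item

-- The head of a context is its innermost item, bound to index 0.
Ctx : Set
Ctx = List Item

defs : Ctx → Subst
defs []         = #
defs (Iλ W ∷ Γ) = exts (defs Γ)
defs (Iδ V ∷ Γ) = expand (defs Γ) V • defs Γ

δnf : Ctx → Term → Term
δnf Γ = expand (defs Γ)

infix 4 _⊢_≃_
record _⊢_≃_ (Γ : Ctx) (A B : Term) : Set where
  constructor mk≃
  field ≃⇒↓ : δnf Γ A ↓ δnf Γ B
open _⊢_≃_ public

≃-≡ : ∀ {Γ A A′ B B′} → A ≡ A′ → B ≡ B′ → Γ ⊢ A ≃ B → Γ ⊢ A′ ≃ B′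
≃-≡ refl refl c = c

≃-refl : ∀ {Γ A} → Γ ⊢ A ≃ A
≃-refl = mk≃ ↓-refl

≃-sym : ∀ {Γ A B} → Γ ⊢ A ≃ B → Γ ⊢ B ≃ A
≃-sym (mk≃ c) = mk≃ (↓-sym c)

≃-trans : ∀ {Γ A B C} → Γ ⊢ A ≃ B → Γ ⊢ B ≃ C → Γ ⊢ A ≃ C
≃-trans (mk≃ c) (mk≃ d) = mk≃ (↓-trans c d)

data Lookup : Ctx → ℕ → Item → Ctx → Set where
  here  : ∀ {b Δ} → Lookup (b ∷ Δ) 0 b Δ
  there : ∀ {Γ k b Δ c} → Lookup Γ k b Δ → Lookup (c ∷ Γ) (suc k) b Δ

Lookup-length : ∀ {Γ k b Δ} → Lookup Γ k b Δ → length Γ ≡ suc (k + length Δ)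
Lookup-length here      = refl
Lookup-length (there l) = cong suc (Lookup-length l)

Lookup-++ : ∀ {Γ k b Δ} → Lookup Γ k b Δ → ∀ Ξ → Lookup (Ξ ++ Γ) (length Ξ + k) b Δ
Lookup-++ l []      = l
Lookup-++ l (c ∷ Ξ) = there (Lookup-++ l Ξ)

Lookup-unique : ∀ {Γ k b b′ Δ Δ′} → Lookup Γ k b Δ → Lookup Γ k b′ Δ′ → b ≡ b′ × Δ ≡ Δ′
Lookup-unique here      here       = refl , refl
Lookup-unique (there l) (there l′) = Lookup-unique l l′

Lookup-split : ∀ Ξ {Γ k b Δ} → Lookup (Ξ ++ Γ) k b Δ →
  (∃[ Ξ′ ] (Δ ≡ Ξ′ ++ Γ × Lookup Ξ k b Ξ′)) ⊎ (∃[ k′ ] (k ≡ length Ξ + k′ × Lookup Γ k′ b Δ))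
Lookup-split []      l         = inj₂ (_ , refl , l)
Lookup-split (c ∷ Ξ) here      = inj₁ (Ξ , refl , here)
Lookup-split (c ∷ Ξ) (there l) with Lookup-split Ξ l
... | inj₁ (Ξ′ , e , l′) = inj₁ (Ξ′ , e , there l′)
... | inj₂ (k′ , e , l′) = inj₂ (k′ , cong suc e , l′)

defs-Lookup : ∀ {Γ k V Δ} → Lookup Γ k (Iδ V) Δ →
  ∃[ ρ ] (defs Γ k ≡ rename ρ (δnf Δ V) × (∀ i → defs Γ (suc k + i) ≡ rename ρ (defs Δ i)))
defs-Lookup here = id , sym (rename-id _) , λ i → sym (rename-id _)
defs-Lookup {Iλ W ∷ Γ} (there l) with defs-Lookup l
... | ρ , p , q = suc ∘ ρ , trans (cong (rename suc) p) (rename-rename suc ρ _) ,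
                  λ i → trans (cong (rename suc) (q i)) (rename-rename suc ρ _)
defs-Lookup {Iδ V ∷ Γ} (there l) = defs-Lookup l

δnf-Lookup : ∀ {Γ k V Δ} → Lookup Γ k (Iδ V) Δ → δnf Γ (shift (suc k) 0 V) ≡ defs Γ k
δnf-Lookup {Γ} {k} {V} {Δ} l with defs-Lookup l
... | ρ , p , q = begin
  δnf Γ (shift (suc k) 0 V)              ≡⟨ cong (δnf Γ) (shift₀ (suc k) V) ⟩
  δnf Γ (rename (suc k +_) V)            ≡⟨ expand-rename (defs Γ) (suc k +_) V ⟩
  expand (defs Γ ∘ (suc k +_)) V         ≡⟨ expand-cong q V ⟩
  expand (rename ρ ∘ defs Δ) V           ≡⟨ rename-expand ρ (defs Δ) V ⟨
  rename ρ (δnf Δ V)                     ≡⟨ p ⟨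
  defs Γ k                               ∎
  where open ≡-Reasoning

infix 4 _⊢_▷_ _⊢_▷*_
data _⊢_▷_ : Ctx → Term → Term → Set where
  δ▷    : ∀ {Γ k V Δ} → Lookup Γ k (Iδ V) Δ → Γ ⊢ # k ▷ shift (suc k) 0 V
  β▷    : ∀ {Γ V W T} → Γ ⊢ appl V (𝛌 W T) ▷ 𝛅 V T
  ζ▷    : ∀ {Γ V T} → Γ ⊢ 𝛅 V (shift 1 0 T) ▷ T
  τ▷    : ∀ {Γ W T} → Γ ⊢ cast W T ▷ T
  υ▷    : ∀ {Γ V U T} → Γ ⊢ appl V (𝛅 U T) ▷ 𝛅 U (appl (shift 1 0 V) T)
  𝛌ˡ    : ∀ {Γ W W′ T} → Γ ⊢ W ▷ W′ → Γ ⊢ 𝛌 W T ▷ 𝛌 W′ T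
  𝛌ʳ    : ∀ {Γ W T T′} → Iλ W ∷ Γ ⊢ T ▷ T′ → Γ ⊢ 𝛌 W T ▷ 𝛌 W T′
  𝛅ˡ    : ∀ {Γ V V′ T} → Γ ⊢ V ▷ V′ → Γ ⊢ 𝛅 V T ▷ 𝛅 V′ T
  𝛅ʳ    : ∀ {Γ V T T′} → Iδ V ∷ Γ ⊢ T ▷ T′ → Γ ⊢ 𝛅 V T ▷ 𝛅 V T′
  applˡ : ∀ {Γ V V′ T} → Γ ⊢ V ▷ V′ → Γ ⊢ appl V T ▷ appl V′ T
  applʳ : ∀ {Γ V T T′} → Γ ⊢ T ▷ T′ → Γ ⊢ appl V T ▷ appl V T′
  castˡ : ∀ {Γ W W′ T} → Γ ⊢ W ▷ W′ → Γ ⊢ cast W T ▷ cast W′ T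
  castʳ : ∀ {Γ W T T′} → Γ ⊢ T ▷ T′ → Γ ⊢ cast W T ▷ cast W T′

_⊢_▷*_ : Ctx → Term → Term → Set
Γ ⊢ A ▷* B = Star (Γ ⊢_▷_) A B

[]₀-expand : ∀ σ X T → expand (exts σ) T [ X ]₀ ≡ expand (X • σ) T
[]₀-expand σ X T = trans (subst-expand (X • #) (exts σ) T) (expand-cong •-exts T)
  where •-exts : subst (X • #) ∘ exts σ ≗ X • σ
        •-exts zero    = refl
        •-exts (suc i) = trans (subst-rename (X • #) suc (σ i)) (subst-id (σ i))

expand-shift₁ : ∀ σ X T → expand (X • σ) (shift 1 0 T) ≡ expand σ T
expand-shift₁ σ X T = trans (cong (expand (X • σ)) (shift₀ 1 T)) (expand-rename (X • σ) suc T)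

[]₀-weaken : ∀ V T → rename suc T [ V ]₀ ≡ T
[]₀-weaken V T = trans (subst-rename (V • #) suc T) (subst-id T)

[]₀-shift₁ : ∀ V T → shift 1 0 T [ V ]₀ ≡ T
[]₀-shift₁ V T = trans (cong (subst (V • #)) (shift₀ 1 T)) ([]₀-weaken V T)

subst-#∘suc : ∀ X → subst (# ∘ suc) X ≡ shift 1 0 X
subst-#∘suc X = trans (subst-# suc X) (sym (shift₀ 1 X))

▷⇒≃ : ∀ {Γ A B} → Γ ⊢ A ▷ B → Γ ⊢ A ≃ B
▷⇒≃ (δ▷ l)                          = mk≃ (↓-reflexive (sym (δnf-Lookup l)))
▷⇒≃ {Γ} (β▷ {V = V} {W} {T})        =
  mk≃ (⇛⇒↓ (≡-subst (δnf Γ (appl V (𝛌 W T)) ⇛_) ([]₀-expand (defs Γ) (δnf Γ V) T)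
                     (β (⇛-refl _) (⇛-refl _))))
▷⇒≃ {Γ} (ζ▷ {V = V} {T = T})        = mk≃ (↓-reflexive (expand-shift₁ (defs Γ) (δnf Γ V) T))
▷⇒≃ τ▷                              = mk≃ (⇛⇒↓ (τ (⇛-refl _)))
▷⇒≃ {Γ} (υ▷ {V = V} {U})            =
  mk≃ (↓-reflexive (cong (λ X → appl X _) (sym (expand-shift₁ (defs Γ) (δnf Γ U) V))))
▷⇒≃ (𝛌ˡ r)                          = mk≃ (↓-𝛌 (≃⇒↓ (▷⇒≃ r)) ↓-refl)
▷⇒≃ (𝛌ʳ r)                          = mk≃ (↓-𝛌 ↓-refl (≃⇒↓ (▷⇒≃ r)))
▷⇒≃ {Γ} (𝛅ˡ {V = V} {V′} {T} r)    = mk≃ (expand-↓ •-↓ T)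
  where •-↓ : δnf Γ V • defs Γ ↓ˢ δnf Γ V′ • defs Γ
        •-↓ zero    = ≃⇒↓ (▷⇒≃ r)
        •-↓ (suc i) = ↓-refl
▷⇒≃ (𝛅ʳ r)                          = mk≃ (≃⇒↓ (▷⇒≃ r))
▷⇒≃ (applˡ r)                       = mk≃ (↓-appl (≃⇒↓ (▷⇒≃ r)) ↓-refl)
▷⇒≃ (applʳ r)                       = mk≃ (↓-appl ↓-refl (≃⇒↓ (▷⇒≃ r)))
▷⇒≃ (castˡ r)                       = mk≃ (↓-cast (≃⇒↓ (▷⇒≃ r)) ↓-refl)
▷⇒≃ (castʳ r)                       = mk≃ (↓-cast ↓-refl (≃⇒↓ (▷⇒≃ r)))

▷*⇒≃ : ∀ {Γ A B} → Γ ⊢ A ▷* B → Γ ⊢ A ≃ B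
▷*⇒≃ ε       = ≃-refl
▷*⇒≃ (r ◅ p) = ≃-trans (▷⇒≃ r) (▷*⇒≃ p)

extsⁿ : ℕ → Subst → Subst
extsⁿ zero    θ = θ
extsⁿ (suc n) θ = exts (extsⁿ n θ)

extsⁿ-+ : ∀ j m θ → extsⁿ (j + m) θ ≗ extsⁿ j (extsⁿ m θ)
extsⁿ-+ zero    m θ i = refl
extsⁿ-+ (suc j) m θ i = exts-cong (extsⁿ-+ j m θ) i

extsⁿ-< : ∀ k m θ → extsⁿ (suc k + m) θ k ≡ # k
extsⁿ-< zero    m θ = refl
extsⁿ-< (suc k) m θ = cong (rename suc) (extsⁿ-< k m θ)

extsⁿ-≥ : ∀ j θ i → extsⁿ j θ (j + i) ≡ rename (j +_) (θ i)
extsⁿ-≥ zero    θ i = sym (rename-id (θ i))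
extsⁿ-≥ (suc j) θ i = trans (cong (rename suc) (extsⁿ-≥ j θ i)) (rename-rename suc (j +_) (θ i))

subst-extsⁿ-rename : ∀ j θ X → subst (extsⁿ j θ) (rename (j +_) X) ≡ rename (j +_) (subst θ X)
subst-extsⁿ-rename j θ X = begin
  subst (extsⁿ j θ) (rename (j +_) X)   ≡⟨ subst-rename (extsⁿ j θ) (j +_) X ⟩
  subst (extsⁿ j θ ∘ (j +_)) X          ≡⟨ subst-cong (extsⁿ-≥ j θ) X ⟩
  subst (rename (j +_) ∘ θ) X           ≡⟨ rename-subst (j +_) θ X ⟨
  rename (j +_) (subst θ X)             ∎
  where open ≡-Reasoning

shift-suc-+ : ∀ n k A → shift (suc (n + k)) 0 A ≡ rename (n +_) (shift (suc k) 0 A)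
shift-suc-+ n k A = begin
  shift (suc (n + k)) 0 A               ≡⟨ shift₀ (suc (n + k)) A ⟩
  rename (suc (n + k) +_) A             ≡⟨ rename-cong +-assoc′ A ⟩
  rename ((n +_) ∘ (suc k +_)) A        ≡⟨ rename-rename (n +_) (suc k +_) A ⟨
  rename (n +_) (rename (suc k +_) A)   ≡⟨ cong (rename (n +_)) (shift₀ (suc k) A) ⟨
  rename (n +_) (shift (suc k) 0 A)     ∎
  where open ≡-Reasoning
        +-assoc′ : ∀ i → suc (n + k) + i ≡ n + (suc k + i)
        +-assoc′ i = trans (cong (_+ i) (sym (+-suc n k))) (+-assoc n (suc k) i)

subst-extsⁿ-shift : ∀ k m θ A →
  subst (extsⁿ (suc k + m) θ) (shift (suc k) 0 A) ≡ shift (suc k) 0 (subst (extsⁿ m θ) A)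
subst-extsⁿ-shift k m θ A = begin
  subst (extsⁿ (suc k + m) θ) (shift (suc k) 0 A)            ≡⟨ cong (subst _) (shift₀ (suc k) A) ⟩
  subst (extsⁿ (suc k + m) θ) (rename (suc k +_) A)          ≡⟨ subst-cong (extsⁿ-+ (suc k) m θ) (rename (suc k +_) A) ⟩
  subst (extsⁿ (suc k) (extsⁿ m θ)) (rename (suc k +_) A)    ≡⟨ subst-extsⁿ-rename (suc k) (extsⁿ m θ) A ⟩
  rename (suc k +_) (subst (extsⁿ m θ) A)                    ≡⟨ shift₀ (suc k) _ ⟨
  shift (suc k) 0 (subst (extsⁿ m θ) A)                      ∎
  where open ≡-Reasoning

subst-extsⁿ-shift-≥ : ∀ n k θ A →
  subst (extsⁿ n θ) (shift (suc (n + k)) 0 A) ≡ rename (n +_) (subst θ (shift (suc k) 0 A))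
subst-extsⁿ-shift-≥ n k θ A =
  trans (cong (subst (extsⁿ n θ)) (shift-suc-+ n k A)) (subst-extsⁿ-rename n θ (shift (suc k) 0 A))

substItem : Subst → Item → Item
substItem θ (Iλ W) = Iλ (subst θ W)
substItem θ (Iδ V) = Iδ (subst θ V)

-- Each item is substituted under the binders of the items behind it.
substCtx : Subst → Ctx → Ctx
substCtx θ []      = []
substCtx θ (b ∷ Ξ) = substItem (extsⁿ (length Ξ) θ) b ∷ substCtx θ Ξ

length-substCtx : ∀ θ Ξ → length (substCtx θ Ξ) ≡ length Ξ
length-substCtx θ []      = refl
length-substCtx θ (b ∷ Ξ) = cong suc (length-substCtx θ Ξ)

Lookup-substCtx : ∀ θ {Ξ k b Ξ′} → Lookup Ξ k b Ξ′ → ∀ Γ →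
  Lookup (substCtx θ Ξ ++ Γ) k (substItem (extsⁿ (length Ξ′) θ) b) (substCtx θ Ξ′ ++ Γ)
Lookup-substCtx θ here      Γ = here
Lookup-substCtx θ (there l) Γ = there (Lookup-substCtx θ l Γ)

extsλ : Ctx → Subst → Subst
extsλ []         κ = κ
extsλ (Iλ _ ∷ Ξ) κ = exts (extsλ Ξ κ)
extsλ (Iδ _ ∷ Ξ) κ = extsλ Ξ κ

-- Native type assignment on list contexts, with the rules def and decl
-- merged into a single rule for variables.

module Typing (g : ℕ → ℕ) where

  infix 4 _⊩_∶_ _⊩ᵢ_∶_
  mutual
    data _⊩_∶_ : Ctx → Term → Term → Set where
      sort : ∀ {Γ h} → Γ ⊩ ⋆ h ∶ ⋆ (g h)
      var  : ∀ {Γ k b Δ A} → Lookup Γ k b Δ → Δ ⊩ᵢ b ∶ A → Γ ⊩ # k ∶ shift (suc k) 0 A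
      abbr : ∀ {Γ V W T U} → Γ ⊩ V ∶ W → Iδ V ∷ Γ ⊩ T ∶ U → Γ ⊩ 𝛅 V T ∶ 𝛅 V U
      abst : ∀ {Γ V W T U} → Γ ⊩ W ∶ V → Iλ W ∷ Γ ⊩ T ∶ U → Γ ⊩ 𝛌 W T ∶ 𝛌 W U
      appl : ∀ {Γ V W T U} → Γ ⊩ V ∶ W → Γ ⊩ T ∶ 𝛌 W U → Γ ⊩ appl V T ∶ appl V (𝛌 W U)
      cast : ∀ {Γ T W V} → Γ ⊩ T ∶ W → Γ ⊩ W ∶ V → Γ ⊩ cast W T ∶ cast V W
      conv : ∀ {Γ T U₁ U₂ W} → Γ ⊩ U₂ ∶ W → Γ ⊩ T ∶ U₁ → Γ ⊢ U₁ ≃ U₂ → Γ ⊩ T ∶ U₂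

    -- Δ ⊩ᵢ b ∶ A : the variable bound by b on top of Δ has type A in Δ.
    data _⊩ᵢ_∶_ (Δ : Ctx) : Item → Term → Set where
      def  : ∀ {V W} → Δ ⊩ V ∶ W → Δ ⊩ᵢ Iδ V ∶ W
      decl : ∀ {W V} → Δ ⊩ W ∶ V → Δ ⊩ᵢ Iλ W ∶ W

  ⊩-≡ : ∀ {Γ T T′ U U′} → T ≡ T′ → U ≡ U′ → Γ ⊩ T ∶ U → Γ ⊩ T′ ∶ U′
  ⊩-≡ refl refl d = d

  -- θ sends every variable of Γ to a term that is typed in Γ′ (also under any
  -- further binders Ξ), and κ relates the δ-normal forms of the two contexts.
  record Morphism (Γ Γ′ : Ctx) : Set where
    field
      θ       : Subst
      κ       : Subst
      θ-typed : ∀ {k b Δ A} → Lookup Γ k b Δ → Δ ⊩ᵢ b ∶ A → ∀ Ξ →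
                substCtx θ Ξ ++ Γ′ ⊩ rename (length Ξ +_) (θ k)
                                   ∶ rename (length Ξ +_) (subst θ (shift (suc k) 0 A))
      θ-δnf   : ∀ i → δnf Γ′ (θ i) ↓ subst κ (defs Γ i)

  module _ {Γ Γ′ : Ctx} (M : Morphism Γ Γ′) where
    open Morphism M

    private
      θ⁺ : Ctx → Subst
      θ⁺ Ξ = extsⁿ (length Ξ) θ

    δnf-mor : ∀ Ξ i → δnf (substCtx θ Ξ ++ Γ′) (θ⁺ Ξ i) ↓ subst (extsλ Ξ κ) (defs (Ξ ++ Γ) i)
    δnf-mor []         i       = θ-δnf i
    δnf-mor (Iλ W ∷ Ξ) zero    = ↓-refl
    δnf-mor (Iλ W ∷ Ξ) (suc i) = begin
      δnf (Iλ (subst (θ⁺ Ξ) W) ∷ Γ₂) (rename suc (θ⁺ Ξ i))     ≡⟨ expand-rename (exts (defs Γ₂)) suc (θ⁺ Ξ i) ⟩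
      expand (rename suc ∘ defs Γ₂) (θ⁺ Ξ i)                  ≡⟨ rename-expand suc (defs Γ₂) (θ⁺ Ξ i) ⟨
      rename suc (δnf Γ₂ (θ⁺ Ξ i))                            ≈⟨ ↓-rename suc (δnf-mor Ξ i) ⟩
      rename suc (subst (extsλ Ξ κ) (defs (Ξ ++ Γ) i))        ≡⟨ rename-subst suc (extsλ Ξ κ) (defs (Ξ ++ Γ) i) ⟩
      subst (rename suc ∘ extsλ Ξ κ) (defs (Ξ ++ Γ) i)        ≡⟨ subst-rename (exts (extsλ Ξ κ)) suc (defs (Ξ ++ Γ) i) ⟨
      subst (exts (extsλ Ξ κ)) (rename suc (defs (Ξ ++ Γ) i)) ∎
      where open ↓-Reasoning
            Γ₂ : Ctx
            Γ₂ = substCtx θ Ξ ++ Γ′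
    δnf-mor (Iδ V ∷ Ξ) zero    = begin
      δnf Γ₂ (subst (θ⁺ Ξ) V)                        ≡⟨ expand-subst (defs Γ₂) (θ⁺ Ξ) V ⟩
      expand (δnf Γ₂ ∘ θ⁺ Ξ) V                       ≈⟨ expand-↓ (δnf-mor Ξ) V ⟩
      expand (subst (extsλ Ξ κ) ∘ defs (Ξ ++ Γ)) V   ≡⟨ subst-expand (extsλ Ξ κ) (defs (Ξ ++ Γ)) V ⟨
      subst (extsλ Ξ κ) (δnf (Ξ ++ Γ) V)             ∎
      where open ↓-Reasoning
            Γ₂ : Ctx
            Γ₂ = substCtx θ Ξ ++ Γ′
    δnf-mor (Iδ V ∷ Ξ) (suc i) = begin
      δnf (Iδ (subst (θ⁺ Ξ) V) ∷ Γ₂) (rename suc (θ⁺ Ξ i))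
        ≡⟨ expand-rename (δnf Γ₂ (subst (θ⁺ Ξ) V) • defs Γ₂) suc (θ⁺ Ξ i) ⟩
      δnf Γ₂ (θ⁺ Ξ i)                                     ≈⟨ δnf-mor Ξ i ⟩
      subst (extsλ Ξ κ) (defs (Ξ ++ Γ) i)                 ∎
      where open ↓-Reasoning
            Γ₂ : Ctx
            Γ₂ = substCtx θ Ξ ++ Γ′

    ≃-mor : ∀ Ξ {A B} → Ξ ++ Γ ⊢ A ≃ B → substCtx θ Ξ ++ Γ′ ⊢ subst (θ⁺ Ξ) A ≃ subst (θ⁺ Ξ) B
    ≃-mor Ξ {A} {B} (mk≃ c) = mk≃ (begin
      δnf Γ₂ (subst (θ⁺ Ξ) A)                   ≡⟨ expand-subst (defs Γ₂) (θ⁺ Ξ) A ⟩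
      expand (δnf Γ₂ ∘ θ⁺ Ξ) A                  ≈⟨ expand-↓ (δnf-mor Ξ) A ⟩
      expand (subst κ′ ∘ defs (Ξ ++ Γ)) A       ≡⟨ subst-expand κ′ (defs (Ξ ++ Γ)) A ⟨
      subst κ′ (δnf (Ξ ++ Γ) A)                 ≈⟨ ↓-subst κ′ c ⟩
      subst κ′ (δnf (Ξ ++ Γ) B)                 ≡⟨ subst-expand κ′ (defs (Ξ ++ Γ)) B ⟩
      expand (subst κ′ ∘ defs (Ξ ++ Γ)) B       ≈⟨ expand-↓ (δnf-mor Ξ) B ⟨
      expand (δnf Γ₂ ∘ θ⁺ Ξ) B                  ≡⟨ expand-subst (defs Γ₂) (θ⁺ Ξ) B ⟨
      δnf Γ₂ (subst (θ⁺ Ξ) B)                   ∎)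
      where open ↓-Reasoning
            Γ₂ : Ctx
            Γ₂ = substCtx θ Ξ ++ Γ′
            κ′ : Subst
            κ′ = extsλ Ξ κ

    mutual
      ⊩-mor : ∀ Ξ {T U} → Ξ ++ Γ ⊩ T ∶ U → substCtx θ Ξ ++ Γ′ ⊩ subst (θ⁺ Ξ) T ∶ subst (θ⁺ Ξ) U
      ⊩-mor Ξ sort = sort
      ⊩-mor Ξ (var {k = k} {A = A} l t) with Lookup-split Ξ l
      ... | inj₁ (Ξ′ , refl , l′) rewrite Lookup-length l′ =
        ⊩-≡ (sym (extsⁿ-< k (length Ξ′) θ)) (sym (subst-extsⁿ-shift k (length Ξ′) θ A))
          (var (Lookup-substCtx θ l′ Γ′) (⊩ᵢ-mor Ξ′ t))
      ... | inj₂ (k′ , refl , l′) =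
        ⊩-≡ (sym (extsⁿ-≥ (length Ξ) θ k′)) (sym (subst-extsⁿ-shift-≥ (length Ξ) k′ θ A))
          (θ-typed l′ t Ξ)
      ⊩-mor Ξ (abbr {V = V} d e) = abbr (⊩-mor Ξ d) (⊩-mor (Iδ V ∷ Ξ) e)
      ⊩-mor Ξ (abst {W = W} d e) = abst (⊩-mor Ξ d) (⊩-mor (Iλ W ∷ Ξ) e)
      ⊩-mor Ξ (appl d e)         = appl (⊩-mor Ξ d) (⊩-mor Ξ e)
      ⊩-mor Ξ (cast d e)         = cast (⊩-mor Ξ d) (⊩-mor Ξ e)
      ⊩-mor Ξ (conv d e c)       = conv (⊩-mor Ξ d) (⊩-mor Ξ e) (≃-mor Ξ c)

      ⊩ᵢ-mor : ∀ Ξ {b A} → Ξ ++ Γ ⊩ᵢ b ∶ A →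
               substCtx θ Ξ ++ Γ′ ⊩ᵢ substItem (θ⁺ Ξ) b ∶ subst (θ⁺ Ξ) A
      ⊩ᵢ-mor Ξ (def d)  = def (⊩-mor Ξ d)
      ⊩ᵢ-mor Ξ (decl d) = decl (⊩-mor Ξ d)

  ⊩-var-++ : ∀ Ξ {Γ k b Δ A} → Lookup Γ k b Δ → Δ ⊩ᵢ b ∶ A →
             Ξ ++ Γ ⊩ # (length Ξ + k) ∶ rename (length Ξ +_) (shift (suc k) 0 A)
  ⊩-var-++ Ξ {k = k} {A = A} l t =
    ⊩-≡ refl (shift-suc-+ (length Ξ) k A) (var (Lookup-++ l Ξ) t)

  ⊩-var-substCtx : ∀ θ Ξ {Γ k b Δ A} → Lookup Γ k b Δ → Δ ⊩ᵢ b ∶ A →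
                   substCtx θ Ξ ++ Γ ⊩ # (length Ξ + k) ∶ rename (length Ξ +_) (shift (suc k) 0 A)
  ⊩-var-substCtx θ Ξ l t rewrite sym (length-substCtx θ Ξ) = ⊩-var-++ (substCtx θ Ξ) l t

  weakenMorphism : ∀ b Γ → Morphism Γ (b ∷ Γ)
  weakenMorphism b Γ = record
    { θ = # ∘ suc ; κ = κ b ; θ-typed = θ-typed ; θ-δnf = θ-δnf b }
    where
      κ : Item → Subst
      κ (Iλ _) = # ∘ suc
      κ (Iδ _) = #

      θ-typed : ∀ {k c Δ A} → Lookup Γ k c Δ → Δ ⊩ᵢ c ∶ A → ∀ Ξ →
                substCtx (# ∘ suc) Ξ ++ b ∷ Γ ⊩ # (length Ξ + suc k)
                                              ∶ rename (length Ξ +_) (subst (# ∘ suc) (shift (suc k) 0 A))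
      θ-typed {k} {A = A} l t Ξ = ⊩-≡ refl (cong (rename (length Ξ +_)) shift-suc) (⊩-var-substCtx (# ∘ suc) Ξ (there l) t)
        where shift-suc : shift (suc (suc k)) 0 A ≡ subst (# ∘ suc) (shift (suc k) 0 A)
              shift-suc = trans (sym (shift-shift (suc k) A)) (sym (subst-#∘suc (shift (suc k) 0 A)))

      θ-δnf : ∀ b i → δnf (b ∷ Γ) (# (suc i)) ↓ subst (κ b) (defs Γ i)
      θ-δnf (Iλ W) i = ↓-reflexive (sym (subst-# suc (defs Γ i)))
      θ-δnf (Iδ V) i = ↓-reflexive (sym (subst-id (defs Γ i)))

  ⊩-weaken : ∀ b {Γ X Y} → Γ ⊩ X ∶ Y → b ∷ Γ ⊩ rename suc X ∶ rename suc Y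
  ⊩-weaken b {Γ} {X} {Y} d =
    ⊩-≡ (subst-# suc X) (subst-# suc Y) (⊩-mor (weakenMorphism b Γ) [] d)

  ≃-shift₁ : ∀ b {Γ A B} → Γ ⊢ A ≃ B → b ∷ Γ ⊢ shift 1 0 A ≃ shift 1 0 B
  ≃-shift₁ b {Γ} {A} {B} c =
    ≃-≡ (subst-#∘suc A) (subst-#∘suc B) (≃-mor (weakenMorphism b Γ) [] c)

  ⊩-weaken* : ∀ Ξ {Δ X Y} → Δ ⊩ X ∶ Y → Ξ ++ Δ ⊩ rename (length Ξ +_) X ∶ rename (length Ξ +_) Y
  ⊩-weaken* []      {X = X} {Y} d = ⊩-≡ (sym (rename-id X)) (sym (rename-id Y)) d
  ⊩-weaken* (b ∷ Ξ) {X = X} {Y} d =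
    ⊩-≡ (rename-rename suc _ X) (rename-rename suc _ Y) (⊩-weaken b (⊩-weaken* Ξ d))

  ⊩-weaken-Lookup : ∀ {Γ k b Δ X Y} → Lookup Γ k b Δ → Δ ⊩ X ∶ Y →
                    Γ ⊩ shift (suc k) 0 X ∶ shift (suc k) 0 Y
  ⊩-weaken-Lookup {X = X} {Y} (here {b}) d =
    ⊩-≡ (sym (shift₀ 1 X)) (sym (shift₀ 1 Y)) (⊩-weaken b d)
  ⊩-weaken-Lookup {_ ∷ _} {suc k} {X = X} {Y} (there {c = c} l) d =
    ⊩-≡ (shift-suc X) (shift-suc Y) (⊩-weaken c (⊩-weaken-Lookup l d))
    where shift-suc : ∀ Z → rename suc (shift (suc k) 0 Z) ≡ shift (suc (suc k)) 0 Z
          shift-suc Z = trans (sym (shift₀ 1 _)) (shift-shift (suc k) Z)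

  ⊩-[]₀ : ∀ {Δ V T U} → Iδ V ∷ Δ ⊩ T ∶ U → Δ ⊩ T [ V ]₀ ∶ U [ V ]₀
  ⊩-[]₀ {Δ} {V} = ⊩-mor M []
    where
      θ-typed : ∀ {k b Δ′ A} → Lookup (Iδ V ∷ Δ) k b Δ′ → Δ′ ⊩ᵢ b ∶ A → ∀ Ξ →
                substCtx (V • #) Ξ ++ Δ ⊩ rename (length Ξ +_) ((V • #) k)
                                        ∶ rename (length Ξ +_) (shift (suc k) 0 A [ V ]₀)
      θ-typed {A = A} here (def d) Ξ rewrite []₀-shift₁ V A | sym (length-substCtx (V • #) Ξ) =
        ⊩-weaken* (substCtx (V • #) Ξ) d
      θ-typed {suc k} {A = A} (there l) t Ξ rewrite sym (shift-shift (suc k) A) | []₀-shift₁ V (shift (suc k) 0 A) =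
        ⊩-var-substCtx (V • #) Ξ l t

      θ-δnf : ∀ i → δnf Δ ((V • #) i) ↓ subst # (defs (Iδ V ∷ Δ) i)
      θ-δnf zero    = ↓-reflexive (sym (subst-id _))
      θ-δnf (suc i) = ↓-reflexive (sym (subst-id _))

      M : Morphism (Iδ V ∷ Δ) Δ
      M = record { θ = V • # ; κ = # ; θ-typed = θ-typed ; θ-δnf = θ-δnf }

  ⊩-replaceHead : ∀ {b b′ Δ} κ →
    (∀ {A} → Δ ⊩ᵢ b ∶ A → b′ ∷ Δ ⊩ # 0 ∶ shift 1 0 A) →
    (∀ i → δnf (b′ ∷ Δ) (# i) ↓ subst κ (defs (b ∷ Δ) i)) →
    ∀ {T U} → b ∷ Δ ⊩ T ∶ U → b′ ∷ Δ ⊩ T ∶ U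
  ⊩-replaceHead {b} {b′} {Δ} κ head-typed θ-δnf {T} {U} d =
    ⊩-≡ (subst-id T) (subst-id U) (⊩-mor M [] d)
    where
      θ-typed : ∀ {k c Δ′ A} → Lookup (b ∷ Δ) k c Δ′ → Δ′ ⊩ᵢ c ∶ A → ∀ Ξ →
                substCtx # Ξ ++ b′ ∷ Δ ⊩ # (length Ξ + k) ∶ rename (length Ξ +_) (subst # (shift (suc k) 0 A))
      θ-typed {A = A} here t Ξ rewrite subst-id (shift 1 0 A) | sym (length-substCtx # Ξ) =
        ⊩-weaken* (substCtx # Ξ) (head-typed t)
      θ-typed {suc k} {A = A} (there l) t Ξ rewrite subst-id (shift (suc (suc k)) 0 A) =
        ⊩-var-substCtx # Ξ (there l) t

      M : Morphism (b ∷ Δ) (b′ ∷ Δ)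
      M = record { θ = # ; κ = κ ; θ-typed = θ-typed ; θ-δnf = θ-δnf }

  ⊩-λ→δ : ∀ {Δ V W T U} → Δ ⊩ V ∶ W → Iλ W ∷ Δ ⊩ T ∶ U → Iδ V ∷ Δ ⊩ T ∶ U
  ⊩-λ→δ {Δ} {V} {W} dV = ⊩-replaceHead (δnf Δ V • #) (λ { (decl _) → var here (def dV) }) θ-δnf
    where θ-δnf : ∀ i → δnf (Iδ V ∷ Δ) (# i) ↓ subst (δnf Δ V • #) (defs (Iλ W ∷ Δ) i)
          θ-δnf zero    = ↓-refl
          θ-δnf (suc i) = ↓-reflexive (sym ([]₀-weaken (δnf Δ V) (defs Δ i)))

  ⊩-redefine : ∀ {Δ V V′ T U} → (∀ {A} → Δ ⊩ V ∶ A → Δ ⊩ V′ ∶ A) → Δ ⊢ V′ ≃ V →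
               Iδ V ∷ Δ ⊩ T ∶ U → Iδ V′ ∷ Δ ⊩ T ∶ U
  ⊩-redefine {Δ} {V} {V′} retype (mk≃ c) = ⊩-replaceHead # (λ { (def d) → var here (def (retype d)) }) θ-δnf
    where θ-δnf : ∀ i → δnf (Iδ V′ ∷ Δ) (# i) ↓ subst # (defs (Iδ V ∷ Δ) i)
          θ-δnf zero    = ↓-trans c (↓-reflexive (sym (subst-id _)))
          θ-δnf (suc i) = ↓-reflexive (sym (subst-id _))

  ⊩-redeclare : ∀ {Δ W W′ V′ T U} → Δ ⊩ W′ ∶ V′ → Δ ⊢ W′ ≃ W →
                Iλ W ∷ Δ ⊩ T ∶ U → Iλ W′ ∷ Δ ⊩ T ∶ U
  ⊩-redeclare {Δ} {W} {W′} dW′ c = ⊩-replaceHead # head-typed (λ i → ↓-reflexive (sym (subst-id _)))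
    where head-typed : ∀ {A} → Δ ⊩ᵢ Iλ W ∶ A → Iλ W′ ∷ Δ ⊩ # 0 ∶ shift 1 0 A
          head-typed (decl dW) = conv (⊩-weaken-Lookup here dW) (var here (decl dW′)) (≃-shift₁ (Iλ W′) c)

  𝛌-gen : ∀ {Γ W T Y} → Γ ⊩ 𝛌 W T ∶ Y →
          ∃[ V ] ∃[ U ] (Γ ⊩ W ∶ V × Iλ W ∷ Γ ⊩ T ∶ U × Γ ⊢ 𝛌 W U ≃ Y)
  𝛌-gen (abst d e)   = _ , _ , d , e , ≃-refl
  𝛌-gen (conv _ e c) with 𝛌-gen e
  ... | V , U , d′ , e′ , c′ = V , U , d′ , e′ , ≃-trans c′ c

  𝛅-gen : ∀ {Γ V T Y} → Γ ⊩ 𝛅 V T ∶ Y →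
          ∃[ W ] ∃[ U ] (Γ ⊩ V ∶ W × Iδ V ∷ Γ ⊩ T ∶ U × Γ ⊢ 𝛅 V U ≃ Y)
  𝛅-gen (abbr d e)   = _ , _ , d , e , ≃-refl
  𝛅-gen (conv _ e c) with 𝛅-gen e
  ... | W , U , d′ , e′ , c′ = W , U , d′ , e′ , ≃-trans c′ c

  appl-gen : ∀ {Γ V T Y} → Γ ⊩ appl V T ∶ Y →
             ∃[ W ] ∃[ U ] (Γ ⊩ V ∶ W × Γ ⊩ T ∶ 𝛌 W U × Γ ⊢ appl V (𝛌 W U) ≃ Y)
  appl-gen (appl d e)   = _ , _ , d , e , ≃-refl
  appl-gen (conv _ e c) with appl-gen e
  ... | W , U , d′ , e′ , c′ = W , U , d′ , e′ , ≃-trans c′ c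

  cast-gen : ∀ {Γ W T Y} → Γ ⊩ cast W T ∶ Y →
             ∃[ V ] (Γ ⊩ T ∶ W × Γ ⊩ W ∶ V × Γ ⊢ cast V W ≃ Y)
  cast-gen (cast d e)   = _ , d , e , ≃-refl
  cast-gen (conv _ e c) with cast-gen e
  ... | V , d′ , e′ , c′ = V , d′ , e′ , ≃-trans c′ c

  δvar-gen : ∀ {Γ k V Δ Y} → Lookup Γ k (Iδ V) Δ → Γ ⊩ # k ∶ Y →
             ∃[ A ] (Δ ⊩ V ∶ A × Γ ⊢ shift (suc k) 0 A ≃ Y)
  δvar-gen l (var l′ t) with Lookup-unique l l′
  δvar-gen l (var l′ (def d)) | refl , refl = _ , d , ≃-refl
  δvar-gen l (conv _ e c) with δvar-gen l e
  ... | A , d , c′ = A , d , ≃-trans c′ c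

  ⊩-valid : ∀ {Γ T U} → Γ ⊩ T ∶ U → ∃[ s ] Γ ⊩ U ∶ s
  ⊩-valid sort             = _ , sort
  ⊩-valid (var l (def d))  = _ , ⊩-weaken-Lookup l (proj₂ (⊩-valid d))
  ⊩-valid (var l (decl d)) = _ , ⊩-weaken-Lookup l d
  ⊩-valid (abbr d e)       = _ , abbr d (proj₂ (⊩-valid e))
  ⊩-valid (abst d e)       = _ , abst d (proj₂ (⊩-valid e))
  ⊩-valid (appl d e) with 𝛌-gen (proj₂ (⊩-valid e))
  ... | _ , _ , dW , dU , _ = _ , appl d (abst dW dU)
  ⊩-valid (cast d e)       = _ , cast e (proj₂ (⊩-valid e))
  ⊩-valid (conv d e c)     = _ , d

  retype : ∀ {Γ X X′ Y Y′} → Γ ⊩ X ∶ Y → Γ ⊩ X′ ∶ Y′ → Γ ⊢ Y′ ≃ Y → Γ ⊩ X′ ∶ Y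
  retype d = conv (proj₂ (⊩-valid d))

  ⊩-δ : ∀ {Γ k V Δ Y} → Lookup Γ k (Iδ V) Δ → Γ ⊩ # k ∶ Y → Γ ⊩ shift (suc k) 0 V ∶ Y
  ⊩-δ l d with δvar-gen l d
  ... | _ , dV , c = retype d (⊩-weaken-Lookup l dV) c

  ⊩-β : ∀ {Γ V W T Y} → Γ ⊩ appl V (𝛌 W T) ∶ Y → Γ ⊩ 𝛅 V T ∶ Y
  ⊩-β {Γ} {V} {W} d with appl-gen d
  ... | W₀ , U , dV , dT , c₁ with 𝛌-gen dT
  ... | _ , U₀ , dW , dT₀ , mk≃ c₂ with 𝛌-↓-inj c₂
  ... | W↓W₀ , U₀↓U = retype d (abbr dV′ (⊩-λ→δ dV′ dT₀)) (≃-trans (mk≃ δnf-↓) c₁)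
    where
      dV′ : Γ ⊩ V ∶ W
      dV′ = conv dW dV (mk≃ (↓-sym W↓W₀))
      open ↓-Reasoning
      δnf-↓ : δnf Γ (𝛅 V U₀) ↓ δnf Γ (appl V (𝛌 W₀ U))
      δnf-↓ = begin
        expand (δnf Γ V • defs Γ) U₀                 ≡⟨ []₀-expand (defs Γ) (δnf Γ V) U₀ ⟨
        expand (exts (defs Γ)) U₀ [ δnf Γ V ]₀       ≈⟨ ↓-subst (δnf Γ V • #) U₀↓U ⟩
        expand (exts (defs Γ)) U [ δnf Γ V ]₀        ≈⟨ ⇛⇒↓ (β (⇛-refl (δnf Γ V)) (⇛-refl _)) ⟨
        δnf Γ (appl V (𝛌 W₀ U))                      ∎

  ⊩-ζ : ∀ {Γ V T Y} → Γ ⊩ 𝛅 V (shift 1 0 T) ∶ Y → Γ ⊩ T ∶ Y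
  ⊩-ζ {Γ} {V} {T} d with 𝛅-gen d
  ... | _ , U , _ , dT , c = retype d (⊩-≡ ([]₀-shift₁ V T) refl (⊩-[]₀ dT)) (≃-trans (mk≃ δnf-≡) c)
    where δnf-≡ : δnf Γ (U [ V ]₀) ↓ δnf Γ (𝛅 V U)
          δnf-≡ = ↓-reflexive (trans (expand-subst (defs Γ) (V • #) U) (expand-cong (map-• (δnf Γ) # refl) U))

  ⊩-τ : ∀ {Γ W T Y} → Γ ⊩ cast W T ∶ Y → Γ ⊩ T ∶ Y
  ⊩-τ d with cast-gen d
  ... | _ , dT , _ , c = retype d dT (≃-trans (mk≃ (↓-sym (⇛⇒↓ (τ (⇛-refl _))))) c)

  ⊩-υ : ∀ {Γ V U T Y} → Γ ⊩ appl V (𝛅 U T) ∶ Y → Γ ⊩ 𝛅 U (appl (shift 1 0 V) T) ∶ Y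
  ⊩-υ {Γ} {V} {U₁} {T} d with appl-gen d
  ... | W , U , dV , dT , c₁ with 𝛅-gen dT
  ... | _ , U₂ , dU₁ , dT₁ , mk≃ c₂ =
    retype d (abbr dU₁ (appl dV↑ dT₁↑)) (≃-trans (mk≃ (↓-reflexive δnf-≡)) c₁)
    where
      σ : Subst
      σ = δnf Γ U₁ • defs Γ
      dV↑ : Iδ U₁ ∷ Γ ⊩ shift 1 0 V ∶ rename suc W
      dV↑ = ⊩-≡ (sym (shift₀ 1 V)) refl (⊩-weaken (Iδ U₁) dV)
      dT₁↑ : Iδ U₁ ∷ Γ ⊩ T ∶ rename suc (𝛌 W U)
      dT₁↑ = conv (⊩-weaken (Iδ U₁) (proj₂ (⊩-valid dT))) dT₁
                  (mk≃ (↓-trans c₂ (↓-reflexive (sym (expand-rename σ suc (𝛌 W U))))))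
      δnf-≡ : δnf Γ (𝛅 U₁ (appl (shift 1 0 V) (rename suc (𝛌 W U)))) ≡ δnf Γ (appl V (𝛌 W U))
      δnf-≡ = cong₂ appl (expand-shift₁ (defs Γ) (δnf Γ U₁) V) (expand-rename σ suc (𝛌 W U))

  subject-reduction : ∀ {Γ X X′ Y} → Γ ⊢ X ▷ X′ → Γ ⊩ X ∶ Y → Γ ⊩ X′ ∶ Y
  subject-reduction (δ▷ l) d = ⊩-δ l d
  subject-reduction β▷     d = ⊩-β d
  subject-reduction ζ▷     d = ⊩-ζ d
  subject-reduction τ▷     d = ⊩-τ d
  subject-reduction υ▷     d = ⊩-υ d
  subject-reduction {Γ} (𝛌ˡ {W′ = W′} r) d with 𝛌-gen d
  ... | V , _ , dW , dT , c =
    retype d (abst dW′ (⊩-redeclare dW′ (≃-sym (▷⇒≃ r)) dT)) (≃-trans (≃-sym (▷⇒≃ (𝛌ˡ r))) c)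
    where dW′ : Γ ⊩ W′ ∶ V
          dW′ = subject-reduction r dW
  subject-reduction (𝛌ʳ r) d with 𝛌-gen d
  ... | _ , _ , dW , dT , c = retype d (abst dW (subject-reduction r dT)) c
  subject-reduction (𝛅ˡ r) d with 𝛅-gen d
  ... | _ , U , dV , dT , c =
    retype d (abbr (subject-reduction r dV) (⊩-redefine (subject-reduction r) (≃-sym (▷⇒≃ r)) dT))
      (≃-trans (≃-sym (▷⇒≃ (𝛅ˡ r))) c)
  subject-reduction (𝛅ʳ r) d with 𝛅-gen d
  ... | _ , _ , dV , dT , c = retype d (abbr dV (subject-reduction r dT)) c
  subject-reduction (applˡ r) d with appl-gen d
  ... | _ , _ , dV , dT , c = retype d (appl (subject-reduction r dV) dT) (≃-trans (≃-sym (▷⇒≃ (applˡ r))) c)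
  subject-reduction (applʳ r) d with appl-gen d
  ... | _ , _ , dV , dT , c = retype d (appl dV (subject-reduction r dT)) c
  subject-reduction {Γ} (castˡ {W′ = W′} r) d with cast-gen d
  ... | V , dT , dW , c = retype d (cast (conv dW′ dT (▷⇒≃ r)) dW′) (≃-trans (≃-sym (▷⇒≃ (castʳ r))) c)
    where dW′ : Γ ⊩ W′ ∶ V
          dW′ = subject-reduction r dW
  subject-reduction (castʳ r) d with cast-gen d
  ... | _ , dT , dW , c = retype d (cast (subject-reduction r dT) dW) c

  subject-reduction* : ∀ {Γ X X′ Y} → Γ ⊢ X ▷* X′ → Γ ⊩ X ∶ Y → Γ ⊩ X′ ∶ Y
  subject-reduction* ε       d = d
  subject-reduction* (r ◅ p) d = subject-reduction* p (subject-reduction r d)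

-- The reduction of the paper

Occurs-rename : ∀ ρ j T → Occurs j (rename ρ T) → ∃[ i ] ρ i ≡ j
Occurs-rename ρ j (# i)      var       = i , refl
Occurs-rename ρ j (𝛌 W T)    (𝛌ˡ o)    = Occurs-rename ρ j W o
Occurs-rename ρ j (𝛌 W T)    (𝛌ʳ o)    with Occurs-rename (ext ρ) (suc j) T o
... | suc i , e = i , cong pred e
Occurs-rename ρ j (𝛅 V T)    (𝛅ˡ o)    = Occurs-rename ρ j V o
Occurs-rename ρ j (𝛅 V T)    (𝛅ʳ o)    with Occurs-rename (ext ρ) (suc j) T o
... | suc i , e = i , cong pred e
Occurs-rename ρ j (appl V T) (applˡ o) = Occurs-rename ρ j V o
Occurs-rename ρ j (appl V T) (applʳ o) = Occurs-rename ρ j T o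
Occurs-rename ρ j (cast W T) (castˡ o) = Occurs-rename ρ j W o
Occurs-rename ρ j (cast W T) (castʳ o) = Occurs-rename ρ j T o

¬Occurs-shift : ∀ k V → ¬ Occurs k (shift (suc k) 0 V)
¬Occurs-shift k V o with Occurs-rename (suc k +_) k V (≡-subst (Occurs k) (shift₀ (suc k) V) o)
... | i , e = m≢1+m+n k (sym e)

Sub-none : ∀ i W X → Sub i W false X X
Sub-none i W (⋆ h)      = sort
Sub-none i W (# j)      = keep
Sub-none i W (𝛌 A T)    = 𝛌 (Sub-none i W A) (Sub-none (suc i) (shift 1 0 W) T)
Sub-none i W (𝛅 A T)    = 𝛅 (Sub-none i W A) (Sub-none (suc i) (shift 1 0 W) T)
Sub-none i W (appl A T) = appl (Sub-none i W A) (Sub-none i W T)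
Sub-none i W (cast A T) = cast (Sub-none i W A) (Sub-none i W T)

Sub-false : ∀ {i W b X X′} → Sub i W b X X′ → b ≡ false → X ≡ X′
Sub-false sort                  _ = refl
Sub-false keep                  _ = refl
Sub-false (𝛌 {b₁ = false} s t)    e = cong₂ 𝛌 (Sub-false s refl) (Sub-false t e)
Sub-false (𝛅 {b₁ = false} s t)    e = cong₂ 𝛅 (Sub-false s refl) (Sub-false t e)
Sub-false (appl {b₁ = false} s t) e = cong₂ appl (Sub-false s refl) (Sub-false t e)
Sub-false (cast {b₁ = false} s t) e = cong₂ cast (Sub-false s refl) (Sub-false t e)

replaceVar : ℕ → Term → Subst
replaceVar i W j = if j ≡ᵇ i then W else # j

replaceVar-suc : ∀ i W → replaceVar (suc i) (shift 1 0 W) ≗ exts (replaceVar i W)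
replaceVar-suc i W zero    = refl
replaceVar-suc i W (suc j) with j ≡ᵇ i
... | true  = shift₀ 1 W
... | false = refl

Sub-all : ∀ i W X → ∃[ b ] Sub i W b X (subst (replaceVar i W) X)
Sub-all i W (⋆ h)      = false , sort
Sub-all i W (# j) with j ≡ᵇ i in eq
... | true  rewrite ≡ᵇ⇒≡ j i (≡-subst T (sym eq) tt) = true , repl
... | false = false , keep
Sub-all i W (𝛌 A T)    with Sub-all i W A | Sub-all (suc i) (shift 1 0 W) T
... | b₁ , s | b₂ , t = b₁ ∨ b₂ , 𝛌 s (≡-subst (Sub _ _ b₂ T) (subst-cong (replaceVar-suc i W) T) t)
Sub-all i W (𝛅 A T)    with Sub-all i W A | Sub-all (suc i) (shift 1 0 W) T
... | b₁ , s | b₂ , t = b₁ ∨ b₂ , 𝛅 s (≡-subst (Sub _ _ b₂ T) (subst-cong (replaceVar-suc i W) T) t)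
Sub-all i W (appl A T) with Sub-all i W A | Sub-all i W T
... | b₁ , s | b₂ , t = b₁ ∨ b₂ , appl s t
Sub-all i W (cast A T) with Sub-all i W A | Sub-all i W T
... | b₁ , s | b₂ , t = b₁ ∨ b₂ , cast s t

infix 4 _→₀*_
_→₀*_ : Term → Term → Set
_→₀*_ = Star _→₀_

replaceVar₀-[]₀ : ∀ V T → subst (replaceVar 0 (shift 1 0 V)) T ≡ shift 1 0 (T [ V ]₀)
replaceVar₀-[]₀ V T = begin
  subst (replaceVar 0 (shift 1 0 V)) T   ≡⟨ subst-cong replaceVar₀ T ⟩
  subst (rename suc ∘ (V • #)) T         ≡⟨ rename-subst suc (V • #) T ⟨
  rename suc (T [ V ]₀)                  ≡⟨ shift₀ 1 _ ⟨
  shift 1 0 (T [ V ]₀)                   ∎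
  where open ≡-Reasoning
        replaceVar₀ : replaceVar 0 (shift 1 0 V) ≗ rename suc ∘ (V • #)
        replaceVar₀ zero    = shift₀ 1 V
        replaceVar₀ (suc j) = refl

ζ-step : ∀ {V X T} → X ≡ shift 1 0 T → 𝛅 V X →₀* T
ζ-step refl = ζ refl ◅ ε

-- A δ-step replacing every occurrence of the abbreviated variable (if there is
-- any) followed by a ζ-step.
𝛅-eliminate : ∀ V T → 𝛅 V T →₀* T [ V ]₀
𝛅-eliminate V T with Sub-all 0 (shift 1 0 V) T
... | true  , s = δ refl refl (¬Occurs-shift 0 V , s) ◅ ζ-step (replaceVar₀-[]₀ V T)
... | false , s = ζ-step (trans (Sub-false s refl) (replaceVar₀-[]₀ V T))

⇛⇒→₀* : ∀ {A B} → A ⇛ B → A →₀* B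
⇛⇒→₀* sort       = ε
⇛⇒→₀* var        = ε
⇛⇒→₀* (𝛌 a b)    = Star-cong₂ refl 𝛌 𝛌 (⇛⇒→₀* a) (⇛⇒→₀* b)
⇛⇒→₀* (𝛅 a b)    = Star-cong₂ refl 𝛅 𝛅 (⇛⇒→₀* a) (⇛⇒→₀* b)
⇛⇒→₀* (appl a b) = Star-cong₂ refl appl appl (⇛⇒→₀* a) (⇛⇒→₀* b)
⇛⇒→₀* (cast a b) = Star-cong₂ refl cast cast (⇛⇒→₀* a) (⇛⇒→₀* b)
⇛⇒→₀* (β {V′ = V′} {T′ = T′} a b) =
  Star-cong₂ refl appl appl (⇛⇒→₀* a) (Star-cong₂ refl 𝛌 𝛌 ε (⇛⇒→₀* b)) ◅◅
  β refl refl ◅ 𝛅-eliminate V′ T′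
⇛⇒→₀* (τ a)      = τ refl ◅ ⇛⇒→₀* a

-- Γ ⊢ A ⇒ˡ B is the reduction E ⊢ A ⇒ B of the paper, read in the list context Γ.
infix 4 _⊢_⇒ˡ_
data _⊢_⇒ˡ_ (Γ : Ctx) (A B : Term) : Set where
  free  : A →₀ B → Γ ⊢ A ⇒ˡ B
  delta : ∀ {k V Δ T′} → Lookup Γ k (Iδ V) Δ → A →₀ T′ → Sub k (shift (suc k) 0 V) true T′ B →
          Γ ⊢ A ⇒ˡ B

▷*-𝛌 : ∀ {Γ W W′ T T′} → Γ ⊢ W ▷* W′ → Iλ W ∷ Γ ⊢ T ▷* T′ → Γ ⊢ 𝛌 W T ▷* 𝛌 W′ T′
▷*-𝛌 {W = W} {T′ = T′} p q = gmap (𝛌 W) 𝛌ʳ q ◅◅ gmap (λ X → 𝛌 X T′) 𝛌ˡ p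

▷*-𝛅 : ∀ {Γ V V′ T T′} → Γ ⊢ V ▷* V′ → Iδ V ∷ Γ ⊢ T ▷* T′ → Γ ⊢ 𝛅 V T ▷* 𝛅 V′ T′
▷*-𝛅 {V = V} {T′ = T′} p q = gmap (𝛅 V) 𝛅ʳ q ◅◅ gmap (λ X → 𝛅 X T′) 𝛅ˡ p

▷*-appl : ∀ {Γ V V′ T T′} → Γ ⊢ V ▷* V′ → Γ ⊢ T ▷* T′ → Γ ⊢ appl V T ▷* appl V′ T′
▷*-appl {V = V} {T′ = T′} p q = gmap (appl V) applʳ q ◅◅ gmap (λ X → appl X T′) applˡ p

▷*-cast : ∀ {Γ W W′ T T′} → Γ ⊢ W ▷* W′ → Γ ⊢ T ▷* T′ → Γ ⊢ cast W T ▷* cast W′ T′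
▷*-cast {W = W} {T′ = T′} p q = gmap (cast W) castʳ q ◅◅ gmap (λ X → cast X T′) castˡ p

Sub⇒▷* : ∀ {Γ k V Δ W b X X′} → Lookup Γ k (Iδ V) Δ → W ≡ shift (suc k) 0 V → Sub k W b X X′ →
         Γ ⊢ X ▷* X′
Sub⇒▷* l    e    sort       = ε
Sub⇒▷* l    e    keep       = ε
Sub⇒▷* l    refl repl       = δ▷ l ◅ ε
Sub⇒▷* {k = k} {V} l refl (𝛌 s t) = ▷*-𝛌 (Sub⇒▷* l refl s) (Sub⇒▷* (there l) (shift-shift (suc k) V) t)
Sub⇒▷* {k = k} {V} l refl (𝛅 s t) = ▷*-𝛅 (Sub⇒▷* l refl s) (Sub⇒▷* (there l) (shift-shift (suc k) V) t)
Sub⇒▷* l    e    (appl s t) = ▷*-appl (Sub⇒▷* l e s) (Sub⇒▷* l e t)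
Sub⇒▷* l    e    (cast s t) = ▷*-cast (Sub⇒▷* l e s) (Sub⇒▷* l e t)

→₀⇒▷* : ∀ {Γ A B} → A →₀ B → Γ ⊢ A ▷* B
→₀⇒▷* refl         = ε
→₀⇒▷* (𝛌 a b)      = ▷*-𝛌 (→₀⇒▷* a) (→₀⇒▷* b)
→₀⇒▷* (𝛅 a b)      = ▷*-𝛅 (→₀⇒▷* a) (→₀⇒▷* b)
→₀⇒▷* (appl a b)   = ▷*-appl (→₀⇒▷* a) (→₀⇒▷* b)
→₀⇒▷* (cast a b)   = ▷*-cast (→₀⇒▷* a) (→₀⇒▷* b)
→₀⇒▷* (β a b)      = ▷*-appl (→₀⇒▷* a) (▷*-𝛌 ε (→₀⇒▷* b)) ◅◅ β▷ ◅ ε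
→₀⇒▷* (δ {V₂ = V₂} a b (_ , s)) =
  ▷*-𝛅 (→₀⇒▷* a) (→₀⇒▷* b) ◅◅ gmap (𝛅 V₂) 𝛅ʳ (Sub⇒▷* here refl s)
→₀⇒▷* (ζ a)        = ζ▷ ◅ →₀⇒▷* a
→₀⇒▷* (τ a)        = τ▷ ◅ →₀⇒▷* a
→₀⇒▷* (υ a b c)    = ▷*-appl (→₀⇒▷* a) (▷*-𝛅 (→₀⇒▷* b) (→₀⇒▷* c)) ◅◅ υ▷ ◅ ε

⇒ˡ⇒▷* : ∀ {Γ A B} → Γ ⊢ A ⇒ˡ B → Γ ⊢ A ▷* B
⇒ˡ⇒▷* (free r)      = →₀⇒▷* r
⇒ˡ⇒▷* (delta l r s) = →₀⇒▷* r ◅◅ Sub⇒▷* l refl s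

⇒ˡ-map : ∀ {Γ A B} (f : Term → Term) → (∀ {X X′} → X →₀ X′ → f X →₀ f X′) →
         (∀ {k W X X′} → Sub k W true X X′ → Sub k W true (f X) (f X′)) →
         Γ ⊢ A ⇒ˡ B → Γ ⊢ f A ⇒ˡ f B
⇒ˡ-map f f-→₀ f-Sub (free r)      = free (f-→₀ r)
⇒ˡ-map f f-→₀ f-Sub (delta l r s) = delta l (f-→₀ r) (f-Sub s)

Sub-shift : ∀ {k V b X X′} → Sub (suc k) (shift (suc (suc k)) 0 V) b X X′ →
            Sub (suc k) (shift 1 0 (shift (suc k) 0 V)) b X X′
Sub-shift {k} {V} = ≡-subst (λ W → Sub (suc k) W _ _ _) (sym (shift-shift (suc k) V))

▷⇒⇒ˡ : ∀ {Γ A B} → Γ ⊢ A ▷ B → Γ ⊢ A ⇒ˡ B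
▷⇒⇒ˡ (δ▷ l) = delta l refl repl
▷⇒⇒ˡ β▷     = free (β refl refl)
▷⇒⇒ˡ ζ▷     = free (ζ refl)
▷⇒⇒ˡ τ▷     = free (τ refl)
▷⇒⇒ˡ υ▷     = free (υ refl refl refl)
▷⇒⇒ˡ (𝛌ˡ {T = T} r)    =
  ⇒ˡ-map (λ X → 𝛌 X T) (λ x → 𝛌 x refl) (λ s → 𝛌 s (Sub-none _ _ T)) (▷⇒⇒ˡ r)
▷⇒⇒ˡ (𝛅ˡ {T = T} r)    =
  ⇒ˡ-map (λ X → 𝛅 X T) (λ x → 𝛅 x refl) (λ s → 𝛅 s (Sub-none _ _ T)) (▷⇒⇒ˡ r)
▷⇒⇒ˡ (applˡ {T = T} r) =
  ⇒ˡ-map (λ X → appl X T) (λ x → appl x refl) (λ s → appl s (Sub-none _ _ T)) (▷⇒⇒ˡ r)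
▷⇒⇒ˡ (applʳ {V = V} r) = ⇒ˡ-map (appl V) (appl refl) (appl (Sub-none _ _ V)) (▷⇒⇒ˡ r)
▷⇒⇒ˡ (castˡ {T = T} r) =
  ⇒ˡ-map (λ X → cast X T) (λ x → cast x refl) (λ s → cast s (Sub-none _ _ T)) (▷⇒⇒ˡ r)
▷⇒⇒ˡ (castʳ {W = W} r) = ⇒ˡ-map (cast W) (cast refl) (cast (Sub-none _ _ W)) (▷⇒⇒ˡ r)
▷⇒⇒ˡ (𝛌ʳ {W = W} r) with ▷⇒⇒ˡ r
... | free r′              = free (𝛌 refl r′)
... | delta {V = V} (there l) r′ s = delta l (𝛌 refl r′) (𝛌 (Sub-none _ _ W) (Sub-shift {V = V} s))
▷⇒⇒ˡ (𝛅ʳ {V = U} r) with ▷⇒⇒ˡ r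
... | free r′                      = free (𝛅 refl r′)
... | delta {V = V} here r′ s      = free (δ refl r′ (¬Occurs-shift 0 V , s))
... | delta {V = V} (there l) r′ s = delta l (𝛅 refl r′) (𝛅 (Sub-none _ _ U) (Sub-shift {V = V} s))

renameItem : Ren → Item → Item
renameItem ρ (Iλ W) = Iλ (rename ρ W)
renameItem ρ (Iδ V) = Iδ (rename ρ V)

DefRen : Ren → Ctx → Ctx → Set
DefRen ρ Γ Γ′ = ∀ {k V Δ} → Lookup Γ k (Iδ V) Δ →
  ∃[ V′ ] ∃[ Δ′ ] (Lookup Γ′ (ρ k) (Iδ V′) Δ′ × rename ρ (shift (suc k) 0 V) ≡ shift (suc (ρ k)) 0 V′)

rename-shift₁ : ∀ ρ T → rename (ext ρ) (shift 1 0 T) ≡ shift 1 0 (rename ρ T)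
rename-shift₁ ρ T = begin
  rename (ext ρ) (shift 1 0 T)     ≡⟨ cong (rename (ext ρ)) (shift₀ 1 T) ⟩
  rename (ext ρ) (rename suc T)    ≡⟨ rename-rename (ext ρ) suc T ⟩
  rename (suc ∘ ρ) T               ≡⟨ rename-rename suc ρ T ⟨
  rename suc (rename ρ T)          ≡⟨ shift₀ 1 _ ⟨
  shift 1 0 (rename ρ T)           ∎
  where open ≡-Reasoning

DefRen-ext : ∀ {ρ Γ Γ′} b → DefRen ρ Γ Γ′ → DefRen (ext ρ) (b ∷ Γ) (renameItem ρ b ∷ Γ′)
DefRen-ext {ρ} (Iδ V) ρ-ok here = rename ρ V , _ , here , rename-shift₁ ρ V
DefRen-ext {ρ} b ρ-ok {suc k} {V} (there l) with ρ-ok l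
... | V′ , Δ′ , l′ , e = V′ , Δ′ , there l′ , (begin
  rename (ext ρ) (shift (suc (suc k)) 0 V)          ≡⟨ cong (rename (ext ρ)) (shift-shift (suc k) V) ⟨
  rename (ext ρ) (shift 1 0 (shift (suc k) 0 V))    ≡⟨ rename-shift₁ ρ (shift (suc k) 0 V) ⟩
  shift 1 0 (rename ρ (shift (suc k) 0 V))          ≡⟨ cong (shift 1 0) e ⟩
  shift 1 0 (shift (suc (ρ k)) 0 V′)                ≡⟨ shift-shift _ V′ ⟩
  shift (suc (suc (ρ k))) 0 V′                      ∎)
  where open ≡-Reasoning

rename-▷ : ∀ {ρ Γ Γ′ A B} → DefRen ρ Γ Γ′ → Γ ⊢ A ▷ B → Γ′ ⊢ rename ρ A ▷ rename ρ B
rename-▷ ρ-ok (δ▷ l) with ρ-ok l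
... | _ , _ , l′ , e = ≡-subst (_ ⊢ _ ▷_) (sym e) (δ▷ l′)
rename-▷ ρ-ok β▷ = β▷
rename-▷ {ρ} ρ-ok (ζ▷ {V = V} {T = T}) =
  ≡-subst (λ X → _ ⊢ 𝛅 (rename ρ V) X ▷ rename ρ T) (sym (rename-shift₁ ρ T)) ζ▷
rename-▷ {ρ} ρ-ok (υ▷ {V = V} {U} {T}) =
  ≡-subst (λ X → _ ⊢ appl (rename ρ V) (𝛅 (rename ρ U) (rename (ext ρ) T))
                   ▷ 𝛅 (rename ρ U) (appl X (rename (ext ρ) T)))
    (sym (rename-shift₁ ρ V)) υ▷
rename-▷ ρ-ok τ▷ = τ▷
rename-▷ ρ-ok (𝛌ˡ r)            = 𝛌ˡ (rename-▷ ρ-ok r)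
rename-▷ ρ-ok (𝛌ʳ {W = W} r)    = 𝛌ʳ (rename-▷ (DefRen-ext (Iλ W) ρ-ok) r)
rename-▷ ρ-ok (𝛅ˡ r)            = 𝛅ˡ (rename-▷ ρ-ok r)
rename-▷ ρ-ok (𝛅ʳ {V = V} r)    = 𝛅ʳ (rename-▷ (DefRen-ext (Iδ V) ρ-ok) r)
rename-▷ ρ-ok (applˡ r)         = applˡ (rename-▷ ρ-ok r)
rename-▷ ρ-ok (applʳ r)         = applʳ (rename-▷ ρ-ok r)
rename-▷ ρ-ok (castˡ r)         = castˡ (rename-▷ ρ-ok r)
rename-▷ ρ-ok (castʳ r)         = castʳ (rename-▷ ρ-ok r)

weaken-▷* : ∀ b {Γ A B} → Γ ⊢ A ▷* B → b ∷ Γ ⊢ rename suc A ▷* rename suc B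
weaken-▷* b {Γ} = gmap (rename suc) (rename-▷ DefRen-suc)
  where DefRen-suc : DefRen suc Γ (b ∷ Γ)
        DefRen-suc {k} {V} l = V , _ , there l , trans (sym (shift₀ 1 _)) (shift-shift (suc k) V)

size : Term → ℕ
size (⋆ h)      = 1
size (# i)      = 1
size (𝛌 W T)    = suc (size W + size T)
size (𝛅 V T)    = suc (size V + size T)
size (appl V T) = suc (size V + size T)
size (cast W T) = suc (size W + size T)

weight : Ctx → ℕ
weight []         = 0
weight (Iλ _ ∷ Γ) = weight Γ
weight (Iδ V ∷ Γ) = size V + weight Γ

-- δnf Γ X lives in the context of the λ-items of Γ alone; skipδ Γ embeds it back into Γ.
skipδ : Ctx → Ren
skipδ []         = id
skipδ (Iλ _ ∷ Γ) = ext (skipδ Γ)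
skipδ (Iδ _ ∷ Γ) = suc ∘ skipδ Γ

private
  split-≤ : ∀ a b w m → a + b + w ≤ m → a + w ≤ m × b + w ≤ m × b + (a + w) ≤ m
  split-≤ a b w m p =
    ≤-trans (+-mono-≤ (m≤m+n a b) (≤-refl {w})) p ,
    ≤-trans (+-mono-≤ (m≤n+m b a) (≤-refl {w})) p ,
    ≤-trans (≤-reflexive (trans (sym (+-assoc b a w)) (cong (_+ w) (+-comm b a)))) p

-- The fuel n bounds size X + weight Γ, which decreases when a variable is
-- traded for the body of its abbreviation.
mutual
  unfold-term : ∀ n Γ X → size X + weight Γ ≤ n → Γ ⊢ X ▷* rename (skipδ Γ) (δnf Γ X)
  unfold-term n       Γ (⋆ h)      p = ε
  unfold-term (suc m) Γ (# i)      p = unfold-var m Γ i (s≤s⁻¹ p)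
  unfold-term (suc m) Γ (𝛌 W T)    p with split-≤ (size W) (size T) (weight Γ) m (s≤s⁻¹ p)
  ... | pW , pT , _ = ▷*-𝛌 (unfold-term m Γ W pW) (unfold-term m (Iλ W ∷ Γ) T pT)
  unfold-term (suc m) Γ (𝛅 V T)    p with split-≤ (size V) (size T) (weight Γ) m (s≤s⁻¹ p)
  ... | _ , _ , pT =
    gmap (𝛅 V) 𝛅ʳ (≡-subst (_ ⊢ T ▷*_) (sym shifted) (unfold-term m (Iδ V ∷ Γ) T pT)) ◅◅ ζ▷ ◅ ε
    where X : Term
          X = δnf (Iδ V ∷ Γ) T
          shifted : shift 1 0 (rename (skipδ Γ) X) ≡ rename (suc ∘ skipδ Γ) X
          shifted = trans (shift₀ 1 _) (rename-rename suc (skipδ Γ) X)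
  unfold-term (suc m) Γ (appl V T) p with split-≤ (size V) (size T) (weight Γ) m (s≤s⁻¹ p)
  ... | pV , pT , _ = ▷*-appl (unfold-term m Γ V pV) (unfold-term m Γ T pT)
  unfold-term (suc m) Γ (cast W T) p with split-≤ (size W) (size T) (weight Γ) m (s≤s⁻¹ p)
  ... | pW , pT , _ = ▷*-cast (unfold-term m Γ W pW) (unfold-term m Γ T pT)

  unfold-var : ∀ n Γ k → weight Γ ≤ n → Γ ⊢ # k ▷* rename (skipδ Γ) (defs Γ k)
  unfold-var n []         k       p = ε
  unfold-var n (Iλ W ∷ Γ) zero    p = ε
  unfold-var n (Iλ W ∷ Γ) (suc k) p =
    ≡-subst (_ ⊢ # (suc k) ▷*_) (trans (rename-rename suc (skipδ Γ) _) (sym (rename-rename (ext (skipδ Γ)) suc _)))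
      (weaken-▷* (Iλ W) (unfold-var n Γ k p))
  unfold-var n (Iδ V ∷ Γ) zero    p =
    δ▷ here ◅ subst₂ (Iδ V ∷ Γ ⊢_▷*_) (sym (shift₀ 1 V)) (rename-rename suc (skipδ Γ) _)
      (weaken-▷* (Iδ V) (unfold-term n Γ V p))
  unfold-var n (Iδ V ∷ Γ) (suc k) p =
    ≡-subst (_ ⊢ # (suc k) ▷*_) (rename-rename suc (skipδ Γ) _)
      (weaken-▷* (Iδ V) (unfold-var n Γ k (≤-trans (m≤n+m (weight Γ) (size V)) p)))

unfold : ∀ Γ X → Γ ⊢ X ▷* rename (skipδ Γ) (δnf Γ X)
unfold Γ X = unfold-term _ Γ X ≤-refl

-- Environments as contexts

⌊_⌋ : Env → Ctx
⌊ ⋆ h ⌋      = []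
⌊ 𝛌 W C ⌋    = ⌊ C ⌋ ++ Iλ W ∷ []
⌊ 𝛅 V C ⌋    = ⌊ C ⌋ ++ Iδ V ∷ []
⌊ appl _ C ⌋ = ⌊ C ⌋
⌊ cast _ C ⌋ = ⌊ C ⌋

⌊⌋-· : ∀ C₁ C₂ → ⌊ C₁ · C₂ ⌋ ≡ ⌊ C₂ ⌋ ++ ⌊ C₁ ⌋
⌊⌋-· (⋆ h)      C₂ = sym (++-identityʳ _)
⌊⌋-· (𝛌 W C)    C₂ = trans (cong (_++ Iλ W ∷ []) (⌊⌋-· C C₂)) (++-assoc ⌊ C₂ ⌋ ⌊ C ⌋ _)
⌊⌋-· (𝛅 V C)    C₂ = trans (cong (_++ Iδ V ∷ []) (⌊⌋-· C C₂)) (++-assoc ⌊ C₂ ⌋ ⌊ C ⌋ _)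
⌊⌋-· (appl V C) C₂ = ⌊⌋-· C C₂
⌊⌋-· (cast W C) C₂ = ⌊⌋-· C C₂

⌊∙𝛅⌋ : ∀ E V → ⌊ E ∙𝛅 V ⌋ ≡ Iδ V ∷ ⌊ E ⌋
⌊∙𝛅⌋ E V = ⌊⌋-· E (𝛅 V (⋆ (top E)))

⌊∙𝛌⌋ : ∀ E W → ⌊ E ∙𝛌 W ⌋ ≡ Iλ W ∷ ⌊ E ⌋
⌊∙𝛌⌋ E W = ⌊⌋-· E (𝛌 W (⋆ (top E)))

binders-length : ∀ C → binders C ≡ length ⌊ C ⌋
binders-length (⋆ h)      = refl
binders-length (𝛌 W C)    = trans (cong suc (binders-length C)) (trans (+-comm 1 _) (sym (length-++ ⌊ C ⌋)))
binders-length (𝛅 V C)    = trans (cong suc (binders-length C)) (trans (+-comm 1 _) (sym (length-++ ⌊ C ⌋)))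
binders-length (appl V C) = binders-length C
binders-length (cast W C) = binders-length C

binders-length+0 : ∀ C → binders C ≡ length ⌊ C ⌋ + 0
binders-length+0 C = trans (binders-length C) (sym (+-identityʳ _))

itemEnv : Item → Env → Env
itemEnv (Iλ W) = 𝛌 W
itemEnv (Iδ V) = 𝛅 V

⌊itemEnv⌋ : ∀ b C → ⌊ itemEnv b C ⌋ ≡ ⌊ C ⌋ ++ b ∷ []
⌊itemEnv⌋ (Iλ W) C = refl
⌊itemEnv⌋ (Iδ V) C = refl

Lookup-middle : ∀ Ξ b Δ → Lookup (Ξ ++ b ∷ Δ) (length Ξ) b Δ
Lookup-middle []      b Δ = here
Lookup-middle (c ∷ Ξ) b Δ = there (Lookup-middle Ξ b Δ)

Lookup-⌊⌋ : ∀ {E C₁ C₂} b → E ≡ C₁ · itemEnv b C₂ → Lookup ⌊ E ⌋ (binders C₂) b ⌊ C₁ ⌋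
Lookup-⌊⌋ {C₁ = C₁} {C₂} b refl rewrite ⌊⌋-· C₁ (itemEnv b C₂) | ⌊itemEnv⌋ b C₂ | binders-length C₂ =
  ≡-subst (λ Γ → Lookup Γ _ b ⌊ C₁ ⌋) (sym (++-assoc ⌊ C₂ ⌋ (b ∷ []) ⌊ C₁ ⌋))
    (Lookup-middle ⌊ C₂ ⌋ b ⌊ C₁ ⌋)

Lookup-⌊⌋⁻¹ : ∀ E {k b Δ} → Lookup ⌊ E ⌋ k b Δ →
  ∃[ C₁ ] ∃[ C₂ ] (E ≡ C₁ · itemEnv b C₂ × binders C₂ ≡ k × ⌊ C₁ ⌋ ≡ Δ)
Lookup-⌊⌋⁻¹ (⋆ h) ()
Lookup-⌊⌋⁻¹ (𝛌 W C) l with Lookup-split ⌊ C ⌋ l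
... | inj₁ (_ , refl , l′) with Lookup-⌊⌋⁻¹ C l′
...   | C₁ , C₂ , refl , k≡ , refl = 𝛌 W C₁ , C₂ , refl , k≡ , refl
Lookup-⌊⌋⁻¹ (𝛌 W C) l | inj₂ (_ , refl , here) = ⋆ 0 , C , refl , binders-length+0 C , refl
Lookup-⌊⌋⁻¹ (𝛅 V C) l with Lookup-split ⌊ C ⌋ l
... | inj₁ (_ , refl , l′) with Lookup-⌊⌋⁻¹ C l′
...   | C₁ , C₂ , refl , k≡ , refl = 𝛅 V C₁ , C₂ , refl , k≡ , refl
Lookup-⌊⌋⁻¹ (𝛅 V C) l | inj₂ (_ , refl , here) = ⋆ 0 , C , refl , binders-length+0 C , refl
Lookup-⌊⌋⁻¹ (appl V C) l with Lookup-⌊⌋⁻¹ C l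
... | C₁ , C₂ , refl , k≡ , Δ≡ = appl V C₁ , C₂ , refl , k≡ , Δ≡
Lookup-⌊⌋⁻¹ (cast W C) l with Lookup-⌊⌋⁻¹ C l
... | C₁ , C₂ , refl , k≡ , Δ≡ = cast W C₁ , C₂ , refl , k≡ , Δ≡

⇒⇒⇒ˡ : ∀ {E A B} → E ⊢ A ⇒ B → ⌊ E ⌋ ⊢ A ⇒ˡ B
⇒⇒⇒ˡ (free r)                     = free r
⇒⇒⇒ˡ (delta C₁ V C₂ e r (_ , s))  = delta (Lookup-⌊⌋ (Iδ V) e) r s

⇒ˡ⇒⇒ : ∀ E {A B} → ⌊ E ⌋ ⊢ A ⇒ˡ B → E ⊢ A ⇒ B
⇒ˡ⇒⇒ E (free r) = free r
⇒ˡ⇒⇒ E (delta {V = V} l r s) with Lookup-⌊⌋⁻¹ E l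
... | C₁ , C₂ , e , refl , _ = delta C₁ V C₂ e r (¬Occurs-shift (binders C₂) V , s)

⇒*⇒▷* : ∀ {E A B} → E ⊢ A ⇒* B → ⌊ E ⌋ ⊢ A ▷* B
⇒*⇒▷* [ r ]   = ⇒ˡ⇒▷* (⇒⇒⇒ˡ r)
⇒*⇒▷* (r ∷ p) = ⇒ˡ⇒▷* (⇒⇒⇒ˡ r) ◅◅ ⇒*⇒▷* p

⇒*⇒⇔ : ∀ {E A B} → E ⊢ A ⇒* B → E ⊢ A ⇔ B
⇒*⇒⇔ [ r ]   = [ fwd r ]
⇒*⇒⇔ (r ∷ p) = fwd r ∷ ⇒*⇒⇔ p

⇔⇒≃ : ∀ {E A B} → E ⊢ A ⇔ B → ⌊ E ⌋ ⊢ A ≃ B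
⇔⇒≃ [ s ]   = SymClosure.fold ≃-sym (▷*⇒≃ ∘ ⇒ˡ⇒▷* ∘ ⇒⇒⇒ˡ) s
⇔⇒≃ (s ∷ p) = ≃-trans (⇔⇒≃ [ s ]) (⇔⇒≃ p)

EqClosure⇒⇔ : ∀ {E A B} → EqClosure (E ⊢_⇒_) A B → E ⊢ A ⇔ B
EqClosure⇒⇔ ε       = [ fwd (free refl) ]
EqClosure⇒⇔ (s ◅ p) = s ∷ EqClosure⇒⇔ p

≃⇒⇔ : ∀ E {A B} → ⌊ E ⌋ ⊢ A ≃ B → E ⊢ A ⇔ B
≃⇒⇔ E {A} {B} (mk≃ (_ , p , q)) =
  EqClosure⇒⇔ ((⇔δnf A ◅◅ ⇛*⇒⇔ p) ◅◅ symmetric _ (⇔δnf B ◅◅ ⇛*⇒⇔ q))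
  where
    ι : Ren
    ι = skipδ ⌊ E ⌋
    ⇔δnf : ∀ X → EqClosure (E ⊢_⇒_) X (rename ι (δnf ⌊ E ⌋ X))
    ⇔δnf X = gmap id (fwd ∘ ⇒ˡ⇒⇒ E ∘ ▷⇒⇒ˡ) (unfold ⌊ E ⌋ X)
    ⇛*⇒⇔ : ∀ {X Y} → X ⇛* Y → EqClosure (E ⊢_⇒_) (rename ι X) (rename ι Y)
    ⇛*⇒⇔ = concat ∘ gmap (rename ι) (gmap id (fwd ∘ free) ∘ ⇛⇒→₀* ∘ rename-⇛ ι)

module _ {g : ℕ → ℕ} where
  open Typing g

  NType⇒⊩ : ∀ {E T U} → NType g E T U → ⌊ E ⌋ ⊩ T ∶ U
  NType⇒⊩ sort                       = sort
  NType⇒⊩ (def C₁ C₂ e d)            = var (Lookup-⌊⌋ (Iδ _) e) (def (NType⇒⊩ d))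
  NType⇒⊩ (decl C₁ C₂ e d)           = var (Lookup-⌊⌋ (Iλ _) e) (decl (NType⇒⊩ d))
  NType⇒⊩ {E} (abbr {V = V} d e)     = abbr (NType⇒⊩ d) (≡-subst (_⊩ _ ∶ _) (⌊∙𝛅⌋ E V) (NType⇒⊩ e))
  NType⇒⊩ {E} (abst {W = W} d e)     = abst (NType⇒⊩ d) (≡-subst (_⊩ _ ∶ _) (⌊∙𝛌⌋ E W) (NType⇒⊩ e))
  NType⇒⊩ (appl d e)                 = appl (NType⇒⊩ d) (NType⇒⊩ e)
  NType⇒⊩ (cast d e)                 = cast (NType⇒⊩ d) (NType⇒⊩ e)
  NType⇒⊩ (conv d e c)               = conv (NType⇒⊩ d) (NType⇒⊩ e) (⇔⇒≃ c)

  ⊩⇒NType : ∀ {Γ T U} E → ⌊ E ⌋ ≡ Γ → Γ ⊩ T ∶ U → NType g E T U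
  ⊩⇒NType E refl sort = sort
  ⊩⇒NType E refl (var l t) with Lookup-⌊⌋⁻¹ E l | t
  ... | C₁ , C₂ , e , refl , Δ≡ | def d  = def C₁ C₂ e (⊩⇒NType C₁ Δ≡ d)
  ... | C₁ , C₂ , e , refl , Δ≡ | decl d = decl C₁ C₂ e (⊩⇒NType C₁ Δ≡ d)
  ⊩⇒NType E refl (abbr {V = V} d e) = abbr (⊩⇒NType E refl d) (⊩⇒NType (E ∙𝛅 V) (⌊∙𝛅⌋ E V) e)
  ⊩⇒NType E refl (abst {W = W} d e) = abst (⊩⇒NType E refl d) (⊩⇒NType (E ∙𝛌 W) (⌊∙𝛌⌋ E W) e)
  ⊩⇒NType E refl (appl d e)         = appl (⊩⇒NType E refl d) (⊩⇒NType E refl e)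
  ⊩⇒NType E refl (cast d e)         = cast (⊩⇒NType E refl d) (⊩⇒NType E refl e)
  ⊩⇒NType E refl (conv d e c)       = conv (⊩⇒NType E refl d) (⊩⇒NType E refl e) (≃⇒⇔ E c)

mainTheorem16 : (g : ℕ → ℕ) → (∀ h → h < g h) →
    (C : Env) (T T₁ T₂ : Term) →
    NType g C T T₁ → C ⊢ T₁ ⇒* T₂ → NType g C T T₂
mainTheorem16 g _ C T T₁ T₂ T∶T₁ T₁⇒*T₂ = conv T₂-typed T∶T₁ (⇒*⇒⇔ T₁⇒*T₂)
  where
    open Typing g
    T₁-typed : ∃[ s ] ⌊ C ⌋ ⊩ T₁ ∶ s
    T₁-typed = ⊩-valid (NType⇒⊩ T∶T₁)
    T₂-typed : NType g C T₂ (proj₁ T₁-typed)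
    T₂-typed = ⊩⇒NType C refl (subject-reduction* (⇒*⇒▷* T₁⇒*T₂) (proj₂ T₁-typed))
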